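{- Let $n$ be a product of (one or more, not necessarily distinct) primes each congruent to $1\pmod 4$, and write $n=P_n\cdot Q_n^2$ with $P_n$ squarefree and $Q_n$ a positive integer. Then \[ f(n)=\frac{1}{4}(Q_n-1)\qquad\text{and}\qquad f(2n)=\frac{1}{4}(Q_n-1-n). \] In particular, if $n$ is squarefree, then $f(n)=0$ and $f(2n)=-\frac{n}{4}$.
   Context: For a positive integer $m$, $f(m):=\sum_{j=1}^{\lfloor m/4\rfloor}\lfloor\sqrt{jm}\rfloor-\frac{m^2-1}{12}$, where $\lfloor x\rfloor$ is the floor function. -}

module Defs where

open import Data.Nat using (ℕ; zero; suc; _+_; _*_; _≤?_; _/_)
open import Data.Nat.Divisibility using (_∣_)
open import Data.List using (List; map; upTo)
open import Data.Nat.ListAction using (sum)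
open import Data.Integer as ℤ using (ℤ; +_)
open import Data.Rational as ℚ using (ℚ; _/_)
open import Relation.Nullary.Decidable using (does)
open import Data.Bool using (if_then_else_)
open import Relation.Binary.PropositionalEquality using (_≡_)

isqrt : ℕ → ℕ
isqrt zero = zero
isqrt (suc n) with isqrt n
... | r = if does (suc r * suc r ≤? suc n) then suc r else r

-- Σ_{j=1}^{⌊m/4⌋} ⌊√(j m)⌋   (upTo k = [0 .. k-1], so j = i + 1)
sqrtSum : ℕ → ℕ
sqrtSum m = sum (map (λ i → isqrt (suc i * m)) (upTo (m Data.Nat./ 4)))

f : ℕ → ℚ
f m = ℚ._-_ (+ sqrtSum m ℚ./ 1) ((+ (m * m) ℤ.- + 1) ℚ./ 12)

SquareFree : ℕ → Set
SquareFree n = ∀ d → d * d ∣ n → d ≡ 1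

-- Let m be n or 2n, L = ⌊m/4⌋ and K with K² ≤ L m < (K + 1)².  Counting the lattice points of
-- [1, L] × [1, K] on either side of the parabola j m = k² gives
--   Σ_{j ≤ L} ⌊√(j m)⌋ + Σ_{k ≤ K} ⌊(k² - 1)/m⌋ = L K,   m ⌊(k² - 1)/m⌋ = k² - (k² mod m) - m [m ∣ k²].
-- Since every prime factor of n is 1 mod 4, -1 is a square modulo n (for a prime p = 2h + 1 with h
-- even, pair each a ∈ [1, h] with its inverse up to sign; then lift through the factorisation of n),
-- and hence also modulo 2n.  Multiplication by a square root of -1 permutes the residues and sends
-- k² mod m to -k² mod m, so the residues of the squares add up to (m² - m Z)/2, where Z counts the
-- k mod m with m ∣ k²; by the symmetry k ↦ m - k essentially half of this comes from 1 ≤ k ≤ K.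
-- Finally m ∣ k² exactly when P Q ∣ k (resp. 2 P Q ∣ k), so Z = Q, and the resulting linear relations
-- determine the sum.

module Submission where

open import Data.Nat.Base using (ℕ; NonZero)


module FiniteSums where

  open import Data.Nat
  open import Data.Nat.Properties
  open import Data.Nat.Tactic.RingSolver using (solve-∀)
  open import Data.List using (map; upTo; applyUpTo)
  open import Data.Nat.ListAction using (sum)
  open import Data.Fin using (Fin; toℕ; fromℕ<)
  open import Data.Fin.Properties using (toℕ<n; toℕ-fromℕ<; toℕ-injective)
  open import Data.Fin.Permutation using (Permutation; permutation)
  open import Algebra.Properties.CommutativeMonoid.Sum +-0-commutativeMonoid
    using (sum-permute; sum-cong-≗) renaming (sum to ∑)
  open import Data.Empty using (⊥-elim)
  open import Relation.Nullary using (Dec; yes; no; ¬_; ¬?)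
  open import Relation.Binary.Definitions using (tri<; tri≈; tri>)
  open import Relation.Binary.PropositionalEquality
  open ≡-Reasoning

  χ : ∀ {a} {A : Set a} → Dec A → ℕ
  χ (yes _) = 1
  χ (no _)  = 0

  module _ {a} {A : Set a} where

    χ-yes : (d : Dec A) → A → χ d ≡ 1
    χ-yes (yes _) _ = refl
    χ-yes (no ¬a) a = ⊥-elim (¬a a)

    χ-no : (d : Dec A) → ¬ A → χ d ≡ 0
    χ-no (yes a) ¬a = ⊥-elim (¬a a)
    χ-no (no _)  _  = refl

    χ-¬? : (d : Dec A) → χ d + χ (¬? d) ≡ 1
    χ-¬? (yes _) = refl
    χ-¬? (no _)  = refl

  χ-cong : ∀ {a b} {A : Set a} {B : Set b} (d : Dec A) (e : Dec B) → (A → B) → (B → A) → χ d ≡ χ e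
  χ-cong (yes _) (yes _) _ _ = refl
  χ-cong (yes a) (no ¬b) f _ = ⊥-elim (¬b (f a))
  χ-cong (no ¬a) (yes b) _ g = ⊥-elim (¬a (g b))
  χ-cong (no _)  (no _)  _ _ = refl

  Σ< : ℕ → (ℕ → ℕ) → ℕ
  Σ< zero    g = 0
  Σ< (suc n) g = g 0 + Σ< n (λ k → g (suc k))

  Σ-cong : ∀ n {g h : ℕ → ℕ} → (∀ k → k < n → g k ≡ h k) → Σ< n g ≡ Σ< n h
  Σ-cong zero    _ = refl
  Σ-cong (suc n) e = cong₂ _+_ (e 0 z<s) (Σ-cong n (λ k k<n → e (suc k) (s<s k<n)))

  Σ-distrib-+ : ∀ n (g h : ℕ → ℕ) → Σ< n (λ k → g k + h k) ≡ Σ< n g + Σ< n h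
  Σ-distrib-+ zero    g h = refl
  Σ-distrib-+ (suc n) g h = begin
    g 0 + h 0 + Σ< n (λ k → g (suc k) + h (suc k))  ≡⟨ cong (g 0 + h 0 +_) (Σ-distrib-+ n _ _) ⟩
    g 0 + h 0 + (Σ< n (g ∘suc) + Σ< n (h ∘suc))     ≡⟨ +-assoc-swap (g 0) (h 0) _ _ ⟩
    g 0 + Σ< n (g ∘suc) + (h 0 + Σ< n (h ∘suc))     ∎
    where
    _∘suc : (ℕ → ℕ) → ℕ → ℕ
    (f ∘suc) k = f (suc k)
    +-assoc-swap : ∀ a b c d → a + b + (c + d) ≡ a + c + (b + d)
    +-assoc-swap = solve-∀

  Σ-*ˡ : ∀ n c (g : ℕ → ℕ) → Σ< n (λ k → c * g k) ≡ c * Σ< n g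
  Σ-*ˡ zero    c g = sym (*-zeroʳ c)
  Σ-*ˡ (suc n) c g = trans (cong (c * g 0 +_) (Σ-*ˡ n c (λ k → g (suc k))))
                           (sym (*-distribˡ-+ c (g 0) _))

  Σ-const : ∀ n c → Σ< n (λ _ → c) ≡ n * c
  Σ-const zero    c = refl
  Σ-const (suc n) c = cong (c +_) (Σ-const n c)

  Σ-zero : ∀ n → Σ< n (λ _ → 0) ≡ 0
  Σ-zero n = trans (Σ-const n 0) (*-zeroʳ n)

  Σ-split : ∀ a b (g : ℕ → ℕ) → Σ< (a + b) g ≡ Σ< a g + Σ< b (λ k → g (a + k))
  Σ-split zero    b g = refl
  Σ-split (suc a) b g = trans (cong (g 0 +_) (Σ-split a b (λ k → g (suc k))))
                              (sym (+-assoc (g 0) _ _))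

  Σ-sucʳ : ∀ n (g : ℕ → ℕ) → Σ< (suc n) g ≡ Σ< n g + g n
  Σ-sucʳ n g = begin
    Σ< (suc n) g               ≡⟨ cong (λ x → Σ< x g) (+-comm 1 n) ⟩
    Σ< (n + 1) g               ≡⟨ Σ-split n 1 g ⟩
    Σ< n g + (g (n + 0) + 0)   ≡⟨ cong (λ x → Σ< n g + x) (trans (+-identityʳ _) (cong g (+-identityʳ n))) ⟩
    Σ< n g + g n               ∎

  Σ-reverse : ∀ n (g : ℕ → ℕ) → Σ< n g ≡ Σ< n (λ k → g (n ∸ suc k))
  Σ-reverse zero    g = refl
  Σ-reverse (suc n) g = begin
    g 0 + Σ< n (λ k → g (suc k))                        ≡⟨ cong (g 0 +_) (Σ-reverse n _) ⟩
    g 0 + Σ< n (λ k → g (suc (n ∸ suc k)))              ≡⟨ cong (g 0 +_) (Σ-cong n (λ k k<n → cong g (sym (+-∸-assoc 1 k<n)))) ⟩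
    g 0 + Σ< n (λ k → g (suc n ∸ suc k))                ≡⟨ +-comm (g 0) _ ⟩
    Σ< n (λ k → g (suc n ∸ suc k)) + g 0                ≡⟨ cong (λ x → Σ< n (λ k → g (suc n ∸ suc k)) + g x) (sym (n∸n≡0 n)) ⟩
    Σ< n (λ k → g (suc n ∸ suc k)) + g (suc n ∸ suc n)  ≡⟨ Σ-sucʳ n _ ⟨
    Σ< (suc n) (λ k → g (suc n ∸ suc k))                ∎

  Σ-comm : ∀ a b (F : ℕ → ℕ → ℕ) → Σ< a (λ j → Σ< b (F j)) ≡ Σ< b (λ k → Σ< a (λ j → F j k))
  Σ-comm zero    b F = sym (Σ-zero b)
  Σ-comm (suc a) b F = trans (cong (Σ< b (F 0) +_) (Σ-comm a b (λ j → F (suc j))))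
                             (sym (Σ-distrib-+ b (F 0) _))

  Σ-χ-< : ∀ n r → r ≤ n → Σ< n (λ k → χ (k <? r)) ≡ r
  Σ-χ-< zero    .zero   z≤n       = refl
  Σ-χ-< (suc n) zero    _         = Σ-zero (suc n)
  Σ-χ-< (suc n) (suc r) (s≤s r≤n) =
    cong suc (trans (Σ-cong n (λ k _ → χ-cong (suc k <? suc r) (k <? r) s<s⁻¹ s<s)) (Σ-χ-< n r r≤n))

  module _ (M : ℕ) (g : ℕ → ℕ) (g-reflect : ∀ a b → a + b ≡ M → g a ≡ g b) where

    Σ-reflect-odd : ∀ K → M ≡ suc (K + K) → Σ< M g ≡ g 0 + 2 * Σ< K (λ k → g (suc k))
    Σ-reflect-odd K refl = begin
      g 0 + Σ< (K + K) G                                   ≡⟨ cong (g 0 +_) (Σ-split K K G) ⟩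
      g 0 + (Σ< K G + Σ< K (λ k → G (K + k)))              ≡⟨ cong (λ x → g 0 + (Σ< K G + x)) (Σ-reverse K _) ⟩
      g 0 + (Σ< K G + Σ< K (λ k → G (K + (K ∸ suc k))))    ≡⟨ cong (λ x → g 0 + (Σ< K G + x)) (Σ-cong K reflected) ⟩
      g 0 + (Σ< K G + Σ< K G)                              ≡⟨ cong (λ x → g 0 + (Σ< K G + x)) (+-identityʳ (Σ< K G)) ⟨
      g 0 + 2 * Σ< K G                                     ∎
      where
      G : ℕ → ℕ
      G k = g (suc k)
      identity : ∀ K d k → suc (K + d) + suc k ≡ suc (K + (d + suc k))
      identity = solve-∀
      reflected : ∀ k → k < K → G (K + (K ∸ suc k)) ≡ G k
      reflected k k<K = g-reflect _ _ (trans (identity K (K ∸ suc k) k) (cong (λ x → suc (K + x)) (m∸n+n≡m k<K)))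

    Σ-reflect-even : ∀ K → M ≡ suc (suc (K + K)) → Σ< M g ≡ g 0 + g (suc K) + 2 * Σ< K (λ k → g (suc k))
    Σ-reflect-even K refl = begin
      g 0 + Σ< (suc K + K) G                                    ≡⟨ cong (g 0 +_) (Σ-split (suc K) K G) ⟩
      g 0 + (Σ< (suc K) G + Σ< K (λ k → G (suc K + k)))         ≡⟨ cong (λ x → g 0 + (x + Σ< K (λ k → G (suc K + k)))) (Σ-sucʳ K G) ⟩
      g 0 + (Σ< K G + G K + Σ< K (λ k → G (suc K + k)))         ≡⟨ cong (λ x → g 0 + (Σ< K G + G K + x)) (Σ-reverse K _) ⟩
      g 0 + (Σ< K G + G K + Σ< K (λ k → G (suc K + (K ∸ suc k)))) ≡⟨ cong (λ x → g 0 + (Σ< K G + G K + x)) (Σ-cong K reflected) ⟩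
      g 0 + (Σ< K G + G K + Σ< K G)                             ≡⟨ identity (g 0) (G K) (Σ< K G) ⟩
      g 0 + G K + 2 * Σ< K G                                    ∎
      where
      G : ℕ → ℕ
      G k = g (suc k)
      identity : ∀ a b x → a + (x + b + x) ≡ a + b + 2 * x
      identity = solve-∀
      identity′ : ∀ K d k → suc (suc K + d) + suc k ≡ suc (suc (K + (d + suc k)))
      identity′ = solve-∀
      reflected : ∀ k → k < K → G (suc K + (K ∸ suc k)) ≡ G k
      reflected k k<K = g-reflect _ _ (trans (identity′ K (K ∸ suc k) k) (cong (λ x → suc (suc (K + x))) (m∸n+n≡m k<K)))

  Σ-squares : ∀ K → 6 * Σ< K (λ k → suc k * suc k) ≡ K * (K + 1) * (2 * K + 1)
  Σ-squares zero    = refl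
  Σ-squares (suc K) = begin
    6 * Σ< (suc K) (λ k → suc k * suc k)                  ≡⟨ cong (6 *_) (Σ-sucʳ K _) ⟩
    6 * (Σ< K (λ k → suc k * suc k) + suc K * suc K)      ≡⟨ *-distribˡ-+ 6 (Σ< K (λ k → suc k * suc k)) (suc K * suc K) ⟩
    6 * Σ< K (λ k → suc k * suc k) + 6 * (suc K * suc K)  ≡⟨ cong (_+ 6 * (suc K * suc K)) (Σ-squares K) ⟩
    K * (K + 1) * (2 * K + 1) + 6 * (suc K * suc K)       ≡⟨ identity K ⟩
    suc K * (suc K + 1) * (2 * suc K + 1)                 ∎
    where
    identity : ∀ K → K * (K + 1) * (2 * K + 1) + 6 * (suc K * suc K) ≡ suc K * (suc K + 1) * (2 * suc K + 1)
    identity = solve-∀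

  sum-upTo : ∀ n (g : ℕ → ℕ) → sum (map g (upTo n)) ≡ Σ< n g
  sum-upTo n g = go n (λ k → k)
    where
    go : ∀ n (f : ℕ → ℕ) → sum (map g (applyUpTo f n)) ≡ Σ< n (λ k → g (f k))
    go zero    f = refl
    go (suc n) f = cong (g (f 0) +_) (go n (λ k → f (suc k)))

  Σ-toFin : ∀ n (g : ℕ → ℕ) → Σ< n g ≡ ∑ {n} (λ i → g (toℕ i))
  Σ-toFin zero    g = refl
  Σ-toFin (suc n) g = cong (g 0 +_) (Σ-toFin n (λ k → g (suc k)))

  Σ-permute : ∀ n (σ τ : ℕ → ℕ) →
              (∀ k → k < n → σ k < n) → (∀ k → k < n → τ k < n) →
              (∀ k → k < n → σ (τ k) ≡ k) → (∀ k → k < n → τ (σ k) ≡ k) →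
              (g : ℕ → ℕ) → Σ< n (λ k → g (σ k)) ≡ Σ< n g
  Σ-permute n σ τ σ< τ< στ τσ g = sym (begin
    Σ< n g                         ≡⟨ Σ-toFin n g ⟩
    ∑ {n} (λ i → g (toℕ i))        ≡⟨ sum-permute (λ i → g (toℕ i)) π ⟩
    ∑ {n} (λ i → g (toℕ (σ′ i)))   ≡⟨ sum-cong-≗ {n} (λ i → cong g (toℕ-fromℕ< _)) ⟩
    ∑ {n} (λ i → g (σ (toℕ i)))    ≡⟨ Σ-toFin n _ ⟨
    Σ< n (λ k → g (σ k))           ∎)
    where
    σ′ τ′ : Fin n → Fin n
    σ′ i = fromℕ< (σ< (toℕ i) (toℕ<n i))
    τ′ i = fromℕ< (τ< (toℕ i) (toℕ<n i))
    σ′τ′ : ∀ i → σ′ (τ′ i) ≡ i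
    σ′τ′ i = toℕ-injective (trans (toℕ-fromℕ< _) (trans (cong σ (toℕ-fromℕ< _)) (στ (toℕ i) (toℕ<n i))))
    τ′σ′ : ∀ i → τ′ (σ′ i) ≡ i
    τ′σ′ i = toℕ-injective (trans (toℕ-fromℕ< _) (trans (cong τ (toℕ-fromℕ< _)) (τσ (toℕ i) (toℕ<n i))))
    π : Permutation n n
    π = permutation σ′ τ′ σ′τ′ τ′σ′

  involution-parity : ∀ h (β : ℕ → ℕ) → (∀ a → a < h → β a < h) → (∀ a → a < h → β (β a) ≡ a) →
                      Σ< h (λ a → χ (β a ≟ a)) + 2 * Σ< h (λ a → χ (a <? β a)) ≡ h
  involution-parity h β β< ββ = begin
    F + 2 * X                  ≡⟨ cong (λ x → F + (X + x)) (+-identityʳ X) ⟩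
    F + (X + X)                ≡⟨ cong (λ x → F + (X + x)) X≡Y ⟩
    F + (X + Y)                ≡⟨ +-assoc F X Y ⟨
    F + X + Y                  ≡⟨ cong (_+ Y) (Σ-distrib-+ h _ _) ⟨
    Σ< h (λ a → χ (β a ≟ a) + χ (a <? β a)) + Y
                               ≡⟨ Σ-distrib-+ h _ _ ⟨
    Σ< h (λ a → χ (β a ≟ a) + χ (a <? β a) + χ (β a <? a))
                               ≡⟨ Σ-cong h (λ a _ → trichotomy (β a) a) ⟩
    Σ< h (λ _ → 1)             ≡⟨ trans (Σ-const h 1) (*-identityʳ h) ⟩
    h                          ∎
    where
    F X Y : ℕ
    F = Σ< h (λ a → χ (β a ≟ a))
    X = Σ< h (λ a → χ (a <? β a))
    Y = Σ< h (λ a → χ (β a <? a))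
    X≡Y : X ≡ Y
    X≡Y = trans (Σ-cong h (λ a a<h → cong (λ x → χ (x <? β a)) (sym (ββ a a<h))))
                (Σ-permute h β β β< β< ββ ββ (λ b → χ (β b <? b)))
    trichotomy : ∀ x y → χ (x ≟ y) + χ (y <? x) + χ (x <? y) ≡ 1
    trichotomy x y with <-cmp x y
    ... | tri< x<y x≢y x≯y = trans (cong₂ (λ u v → u + v + χ (x <? y)) (χ-no (x ≟ y) x≢y) (χ-no (y <? x) x≯y)) (χ-yes (x <? y) x<y)
    ... | tri≈ x≮y x≡y x≯y = trans (cong₂ (λ u v → u + v + χ (x <? y)) (χ-yes (x ≟ y) x≡y) (χ-no (y <? x) x≯y)) (cong suc (χ-no (x <? y) x≮y))
    ... | tri> x≮y x≢y x>y = trans (cong₂ (λ u v → u + v + χ (x <? y)) (χ-no (x ≟ y) x≢y) (χ-yes (y <? x) x>y)) (cong suc (χ-no (x <? y) x≮y))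


module IntegerSquareRoot where

  open import Data.Nat
  open import Data.Nat.Properties
  open import Data.Bool using (true; false; T)
  open import Data.Unit using (tt)
  open import Data.Product using (_×_; _,_; proj₁; proj₂)
  open import Data.Empty using (⊥-elim)
  open import Relation.Nullary using (yes; no)
  open import Relation.Binary.PropositionalEquality
  open import Defs using (isqrt)
  open FiniteSums

  *-cancel-<-square : ∀ {a b} → a * a < b * b → a < b
  *-cancel-<-square {a} {b} p with a <? b
  ... | yes a<b = a<b
  ... | no  a≮b = ⊥-elim (<⇒≱ p (*-mono-≤ (≮⇒≥ a≮b) (≮⇒≥ a≮b)))

  isqrt-spec : ∀ n → isqrt n * isqrt n ≤ n × n < suc (isqrt n) * suc (isqrt n)
  isqrt-spec zero = z≤n , s≤s z≤n
  isqrt-spec (suc n) with isqrt n | isqrt-spec n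
  ... | r | lo , hi with r + r * suc r <ᵇ suc n in eq
  ... | true  = ≤ᵇ⇒≤ (suc r * suc r) (suc n) (subst T (sym eq) tt) , ≤-<-trans hi (*-mono-< (n<1+n (suc r)) (n<1+n (suc r)))
  ... | false = m≤n⇒m≤1+n lo , ≰⇒> (λ p → subst T eq (≤⇒≤ᵇ p))

  isqrt-count : ∀ K x → isqrt x ≤ K → Σ< K (λ k → χ (suc k * suc k ≤? x)) ≡ isqrt x
  isqrt-count K x r≤K = trans (Σ-cong K (λ k _ → χ-cong (suc k * suc k ≤? x) (k <? isqrt x) below above))
                              (Σ-χ-< K (isqrt x) r≤K)
    where
    below : ∀ {k} → suc k * suc k ≤ x → k < isqrt x
    below p = s<s⁻¹ (*-cancel-<-square (≤-<-trans p (proj₂ (isqrt-spec x))))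
    above : ∀ {k} → k < isqrt x → suc k * suc k ≤ x
    above p = ≤-trans (*-mono-≤ p p) (proj₁ (isqrt-spec x))


module LatticePoints where

  open import Data.Nat
  open import Data.Nat.Properties
  open import Data.Nat.DivMod
  open import Data.Nat.Divisibility using (n∣m*n)
  open import Data.Nat.Tactic.RingSolver using (solve-∀)
  open import Data.Product using (proj₁)
  open import Data.Sum using (inj₁; inj₂)
  open import Relation.Nullary using (¬?)
  open import Relation.Binary.PropositionalEquality
  open ≡-Reasoning
  open import Defs using (isqrt; sqrtSum)
  open FiniteSums
  open IntegerSquareRoot

  module _ {m : ℕ} .{{_ : NonZero m}} where

    *≤⇒≤/ : ∀ {a x} → a * m ≤ x → a ≤ x / m
    *≤⇒≤/ {a} {x} p = subst (_≤ x / m) (m*n/n≡m a m) (/-monoˡ-≤ m p)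

    ≤/⇒*≤ : ∀ {a x} → a ≤ x / m → a * m ≤ x
    ≤/⇒*≤ {a} {x} p = ≤-trans (*-monoˡ-≤ m p) (m/n*n≤m x m)

    %-decomposition : ∀ {r} q → r < m → (r + q * m) % m ≡ r
    %-decomposition {r} q r<m = trans ([m+kn]%n≡m%n r q m) (m<n⇒m%n≡m r<m)

    /-decomposition : ∀ {r} q → r < m → (r + q * m) / m ≡ q
    /-decomposition {r} q r<m = trans (+-distrib-/-∣ʳ r (n∣m*n q)) (cong₂ _+_ (m<n⇒m/n≡0 r<m) (m*n/n≡m q m))

    pred-/-%-identity : ∀ y → m * (y / m) + suc y % m + m * χ (suc y % m ≟ 0) ≡ suc y
    pred-/-%-identity y with y % m | y / m | m%n<n y m | m≡m%n+[m/n]*n y m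
    ... | r | q | r<m | refl with m≤n⇒m<n∨m≡n r<m
    ... | inj₁ 1+r<m = begin
      m * q + suc (r + q * m) % m + m * χ (suc (r + q * m) % m ≟ 0)
        ≡⟨ cong (λ b → m * q + b + m * χ (b ≟ 0)) (%-decomposition q 1+r<m) ⟩
      m * q + suc r + m * 0                  ≡⟨ identity m q r ⟩
      suc (r + q * m)                        ∎
      where
      identity : ∀ m q r → m * q + suc r + m * 0 ≡ suc (r + q * m)
      identity = solve-∀
    ... | inj₂ 1+r≡m = begin
      m * q + suc (r + q * m) % m + m * χ (suc (r + q * m) % m ≟ 0)
        ≡⟨ cong (λ b → m * q + b + m * χ (b ≟ 0)) wraps ⟩
      m * q + 0 + m * 1                      ≡⟨ identity m q ⟩
      m + q * m                              ≡⟨ cong (_+ q * m) 1+r≡m ⟨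
      suc (r + q * m)                        ∎
      where
      identity : ∀ m q → m * q + 0 + m * 1 ≡ m + q * m
      identity = solve-∀
      wraps : suc (r + q * m) % m ≡ 0
      wraps = trans (cong (λ z → (z + q * m) % m) 1+r≡m) (%-decomposition (suc q) (>-nonZero⁻¹ m))

    countBelow : ℕ → ℕ
    countBelow k = (suc k * suc k ∸ 1) / m

    Σ-pred-/-%-identity : ∀ K →
      m * Σ< K countBelow + Σ< K (λ k → suc k * suc k % m) + m * Σ< K (λ k → χ (suc k * suc k % m ≟ 0))
      ≡ Σ< K (λ k → suc k * suc k)
    Σ-pred-/-%-identity K = begin
      m * Σ< K c + Σ< K r + m * Σ< K z            ≡⟨ cong₂ (λ a b → a + Σ< K r + b) (Σ-*ˡ K m c) (Σ-*ˡ K m z) ⟨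
      Σ< K (λ k → m * c k) + Σ< K r + Σ< K (λ k → m * z k)
                                                  ≡⟨ cong (_+ Σ< K (λ k → m * z k)) (Σ-distrib-+ K _ r) ⟨
      Σ< K (λ k → m * c k + r k) + Σ< K (λ k → m * z k)
                                                  ≡⟨ Σ-distrib-+ K _ _ ⟨
      Σ< K (λ k → m * c k + r k + m * z k)        ≡⟨ Σ-cong K (λ k _ → pred-/-%-identity (k + k * suc k)) ⟩
      Σ< K (λ k → suc k * suc k)                  ∎
      where
      c r z : ℕ → ℕ
      c = countBelow
      r k = suc k * suc k % m
      z k = χ (suc k * suc k % m ≟ 0)

    -- Both sums count the lattice points of the box [1, L] × [1, K]: the first those with k² ≤ j m, the
    -- second those with j m < k².
    lattice-count : ∀ L K → K * K ≤ L * m → L * m < suc K * suc K →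
                    Σ< L (λ j → isqrt (suc j * m)) + Σ< K countBelow ≡ L * K
    lattice-count L K K²≤Lm Lm<[1+K]² = begin
      Σ< L (λ j → isqrt (suc j * m)) + Σ< K countBelow
                                          ≡⟨ cong₂ _+_ (Σ-cong L row) (Σ-cong K column) ⟩
      Σ< L (λ j → Σ< K (under j)) + Σ< K (λ k → Σ< L (λ j → over j k))
                                          ≡⟨ cong (Σ< L (λ j → Σ< K (under j)) +_) (Σ-comm L K over) ⟨
      Σ< L (λ j → Σ< K (under j)) + Σ< L (λ j → Σ< K (over j))
                                          ≡⟨ Σ-distrib-+ L _ _ ⟨
      Σ< L (λ j → Σ< K (under j) + Σ< K (over j))
                                          ≡⟨ Σ-cong L (λ j _ → Σ-distrib-+ K _ _) ⟨
      Σ< L (λ j → Σ< K (λ k → under j k + over j k))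
                                          ≡⟨ Σ-cong L (λ j _ → Σ-cong K (λ k _ → under+over j k)) ⟩
      Σ< L (λ _ → Σ< K (λ _ → 1))         ≡⟨ Σ-cong L (λ _ _ → trans (Σ-const K 1) (*-identityʳ K)) ⟩
      Σ< L (λ _ → K)                      ≡⟨ Σ-const L K ⟩
      L * K                               ∎
      where
      under over : ℕ → ℕ → ℕ
      under j k = χ (suc k * suc k ≤? suc j * m)
      over  j k = χ (suc j * m <? suc k * suc k)

      under+over : ∀ j k → under j k + over j k ≡ 1
      under+over j k = trans (cong (under j k +_) (χ-cong _ (¬? (suc k * suc k ≤? suc j * m)) <⇒≱ ≰⇒>))
                             (χ-¬? (suc k * suc k ≤? suc j * m))

      row : ∀ j → j < L → isqrt (suc j * m) ≡ Σ< K (under j)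
      row j j<L = sym (isqrt-count K (suc j * m) (s≤s⁻¹ (*-cancel-<-square {isqrt (suc j * m)}
        (≤-<-trans (proj₁ (isqrt-spec (suc j * m))) (≤-<-trans (*-monoˡ-≤ m j<L) Lm<[1+K]²)))))

      column : ∀ k → k < K → countBelow k ≡ Σ< L (λ j → over j k)
      column k k<K = sym (trans (Σ-cong L (λ j _ → χ-cong _ (j <? countBelow k) (λ p → *≤⇒≤/ (s≤s⁻¹ p)) (λ p → s≤s (≤/⇒*≤ p))))
                                (Σ-χ-< L (countBelow k) countBelow≤L))
        where
        countBelow≤L : countBelow k ≤ L
        countBelow≤L = s≤s⁻¹ (m<n*o⇒m/o<n {n = suc L} (≤-trans (*-mono-≤ k<K k<K) (≤-trans K²≤Lm (m≤n+m (L * m) m))))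

    sqrtSum-lattice-count : ∀ L K → m / 4 ≡ L → K * K ≤ L * m → L * m < suc K * suc K →
                            sqrtSum m + Σ< K countBelow ≡ L * K
    sqrtSum-lattice-count L K refl K²≤Lm Lm<[1+K]² =
      trans (cong (_+ Σ< K countBelow) (sum-upTo (m / 4) (λ j → isqrt (suc j * m)))) (lattice-count L K K²≤Lm Lm<[1+K]²)


module Congruence (M : ℕ) .{{_ : NonZero M}} where

  open import Data.Nat
  open import Data.Nat.Properties
  open import Data.Nat.DivMod
  open import Data.Nat.Divisibility using (_∣_; divides; m%n≡0⇒n∣m)
  open import Relation.Binary.Bundles using (Setoid)
  import Relation.Binary.Reasoning.Setoid
  open import Relation.Binary.PropositionalEquality as ≡ using (_≡_; cong; cong₂)

  infix 4 _≈_
  record _≈_ (a b : ℕ) : Set where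
    constructor mk
    field ≈⇒%≡ : a % M ≡ b % M
  open _≈_ public

  ≈-reflexive : ∀ {a b} → a ≡ b → a ≈ b
  ≈-reflexive a≡b = mk (cong (_% M) a≡b)

  ≈-refl : ∀ {a} → a ≈ a
  ≈-refl = mk ≡.refl

  ≈-sym : ∀ {a b} → a ≈ b → b ≈ a
  ≈-sym (mk p) = mk (≡.sym p)

  ≈-trans : ∀ {a b c} → a ≈ b → b ≈ c → a ≈ c
  ≈-trans (mk p) (mk q) = mk (≡.trans p q)

  ≈-setoid : Setoid _ _
  ≈-setoid = record { _≈_ = _≈_ ; isEquivalence = record { refl = ≈-refl ; sym = ≈-sym ; trans = ≈-trans } }

  module ≈-Reasoning = Relation.Binary.Reasoning.Setoid ≈-setoid

  +-cong : ∀ {a a′ b b′} → a ≈ a′ → b ≈ b′ → a + b ≈ a′ + b′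
  +-cong {a} {a′} {b} {b′} (mk p) (mk q) =
    mk (≡.trans (%-distribˡ-+ a b M) (≡.trans (cong₂ (λ x y → (x + y) % M) p q) (≡.sym (%-distribˡ-+ a′ b′ M))))

  *-cong : ∀ {a a′ b b′} → a ≈ a′ → b ≈ b′ → a * b ≈ a′ * b′
  *-cong {a} {a′} {b} {b′} (mk p) (mk q) =
    mk (≡.trans (%-distribˡ-* a b M) (≡.trans (cong₂ (λ x y → (x * y) % M) p q) (≡.sym (%-distribˡ-* a′ b′ M))))

  +-congˡ : ∀ a {b b′} → b ≈ b′ → a + b ≈ a + b′
  +-congˡ a = +-cong (≈-refl {a})

  +-congʳ : ∀ b {a a′} → a ≈ a′ → a + b ≈ a′ + b
  +-congʳ b p = +-cong p (≈-refl {b})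

  *-congˡ : ∀ a {b b′} → b ≈ b′ → a * b ≈ a * b′
  *-congˡ a = *-cong (≈-refl {a})

  *-congʳ : ∀ b {a a′} → a ≈ a′ → a * b ≈ a′ * b
  *-congʳ b p = *-cong p (≈-refl {b})

  %-≈ : ∀ a → a % M ≈ a
  %-≈ a = mk (m%n%n≡m%n a M)

  +-*M-≈ : ∀ a k → a + k * M ≈ a
  +-*M-≈ a k = mk ([m+kn]%n≡m%n a k M)

  *M≈0 : ∀ k → k * M ≈ 0
  *M≈0 k = ≈-trans (≈-reflexive (≡.sym (+-identityˡ (k * M)))) (+-*M-≈ 0 k)

  ≈⇒≡ : ∀ {a b} → a < M → b < M → a ≈ b → a ≡ b
  ≈⇒≡ a<M b<M (mk p) = ≡.trans (≡.sym (m<n⇒m%n≡m a<M)) (≡.trans p (m<n⇒m%n≡m b<M))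

  ∣⇒≈0 : ∀ {a} → M ∣ a → a ≈ 0
  ∣⇒≈0 (divides k ≡.refl) = *M≈0 k

  ≈0⇒∣ : ∀ {a} → a ≈ 0 → M ∣ a
  ≈0⇒∣ {a} (mk p) = m%n≡0⇒n∣m a M (≡.trans p (m<n⇒m%n≡m (>-nonZero⁻¹ M)))

  ∣-square+1-resp-≈ : ∀ {x z} → z ≈ x → M ∣ x * x + 1 → M ∣ z * z + 1
  ∣-square+1-resp-≈ z≈x M∣x²+1 = ≈0⇒∣ (≈-trans (+-congʳ 1 (*-cong z≈x z≈x)) (∣⇒≈0 M∣x²+1))

  -- (M - 1) c is an additive inverse of c modulo M.
  +-cancelʳ : ∀ {a b} c → a + c ≈ b + c → a ≈ b
  +-cancelʳ {a} {b} c a+c≈b+c = begin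
    a                           ≡⟨ +-identityʳ a ⟨
    a + 0                       ≈⟨ +-congˡ a (≈-sym c+c[M-1]≈0) ⟩
    a + (c + pred M * c)        ≡⟨ +-assoc a c _ ⟨
    a + c + pred M * c          ≈⟨ +-congʳ (pred M * c) a+c≈b+c ⟩
    b + c + pred M * c          ≡⟨ +-assoc b c _ ⟩
    b + (c + pred M * c)        ≈⟨ +-congˡ b c+c[M-1]≈0 ⟩
    b + 0                       ≡⟨ +-identityʳ b ⟩
    b                           ∎
    where
    open ≈-Reasoning
    c+c[M-1]≈0 : c + pred M * c ≈ 0
    c+c[M-1]≈0 = ≈-trans (≈-reflexive (≡.trans (cong (λ x → x * c) (suc-pred M)) (*-comm M c))) (*M≈0 c)


module SquareResidues where

  open import Data.Nat
  open import Data.Nat.Properties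
  open import Data.Nat.DivMod
  open import Data.Nat.Divisibility using (_∣_)
  open import Data.Nat.Tactic.RingSolver using (solve-∀)
  open import Relation.Binary.PropositionalEquality
  open FiniteSums

  sq% : (M : ℕ) .{{_ : NonZero M}} → ℕ → ℕ
  sq% M k = k * k % M

  zeroSquares : (M : ℕ) .{{_ : NonZero M}} → ℕ
  zeroSquares M = Σ< M (λ k → χ (sq% M k ≟ 0))

  sq%-reflect : ∀ M .{{_ : NonZero M}} a b → a + b ≡ M → sq% M a ≡ sq% M b
  sq%-reflect M a b refl = begin
    a * a % M                          ≡⟨ [m+kn]%n≡m%n (a * a) (2 * b) M ⟨
    (a * a + 2 * b * (a + b)) % M      ≡⟨ cong (_% M) (identity a b) ⟩
    (b * b + (a + b) * (a + b)) % M    ≡⟨ [m+kn]%n≡m%n (b * b) M M ⟩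
    b * b % M                          ∎
    where
    open ≡-Reasoning
    identity : ∀ a b → a * a + 2 * b * (a + b) ≡ b * b + (a + b) * (a + b)
    identity = solve-∀

  residue+negation : ∀ M′ {r} → r < suc M′ → r + M′ * r % suc M′ + suc M′ * χ (r ≟ 0) ≡ suc M′
  residue+negation M′ {zero}   _           = trans (cong (λ z → z % suc M′ + suc M′ * 1) (*-zeroʳ M′)) (*-identityʳ (suc M′))
  residue+negation M′ {suc r′} (s≤s r′<M′) = begin
    suc r′ + M′ * suc r′ % M + M * 0  ≡⟨ cong (λ z → suc r′ + z % M + M * 0) M′[1+r′]≡ ⟩
    suc r′ + (d + r′ * M) % M + M * 0 ≡⟨ cong (λ z → suc r′ + z + M * 0) (%-decomposition r′ (s≤s (m∸n≤m M′ r′))) ⟩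
    suc r′ + d + M * 0                ≡⟨ identity r′ d M ⟩
    suc (d + r′)                      ≡⟨ cong suc d+r′≡M′ ⟩
    M                                 ∎
    where
    open ≡-Reasoning
    open LatticePoints using (%-decomposition)
    M = suc M′
    d = M′ ∸ r′
    d+r′≡M′ : d + r′ ≡ M′
    d+r′≡M′ = m∸n+n≡m (<⇒≤ r′<M′)
    identity : ∀ r d m → suc r + d + m * 0 ≡ suc (d + r)
    identity = solve-∀
    M′[1+r′]≡ : M′ * suc r′ ≡ d + r′ * M
    M′[1+r′]≡ = begin
      M′ * suc r′              ≡⟨ cong (_* suc r′) d+r′≡M′ ⟨
      (d + r′) * suc r′        ≡⟨ identity′ d r′ ⟩
      d + r′ * suc (d + r′)    ≡⟨ cong (λ z → d + r′ * suc z) d+r′≡M′ ⟩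
      d + r′ * M               ∎
      where
      identity′ : ∀ d r → (d + r) * suc r ≡ d + r * suc (d + r)
      identity′ = solve-∀

  module MultiplicationByRootOfMinusOne (M′ i : ℕ) (M∣i²+1 : suc M′ ∣ i * i + 1) where

    M = suc M′
    open Congruence M
    open ≈-Reasoning

    σ τ : ℕ → ℕ
    σ k = i * k % M
    τ k = M′ * i * k % M

    σ< : ∀ k → k < M → σ k < M
    σ< k _ = m%n<n (i * k) M

    τ< : ∀ k → k < M → τ k < M
    τ< k _ = m%n<n (M′ * i * k) M

    i²≈-1 : i * i ≈ M′
    i²≈-1 = begin
      i * i                ≈⟨ +-*M-≈ (i * i) 1 ⟨
      i * i + 1 * M        ≡⟨ identity (i * i) M′ ⟩
      (i * i + 1) + M′     ≈⟨ +-congʳ M′ (∣⇒≈0 M∣i²+1) ⟩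
      M′                   ∎
      where
      identity : ∀ a b → a + 1 * suc b ≡ (a + 1) + b
      identity = solve-∀

    -[i²]≈1 : M′ * i * i ≈ 1
    -[i²]≈1 = begin
      M′ * i * i           ≡⟨ *-assoc M′ i i ⟩
      M′ * (i * i)         ≈⟨ *-congˡ M′ i²≈-1 ⟩
      M′ * M′              ≈⟨ +-*M-≈ (M′ * M′) 2 ⟨
      M′ * M′ + 2 * M      ≡⟨ identity M′ ⟩
      1 + M * M            ≈⟨ +-*M-≈ 1 M ⟩
      1                    ∎
      where
      identity : ∀ x → x * x + 2 * suc x ≡ 1 + suc x * suc x
      identity = solve-∀

    στ : ∀ k → k < M → σ (τ k) ≡ k
    στ k k<M = ≈⇒≡ (σ< (τ k) (τ< k k<M)) k<M (begin
      i * (M′ * i * k % M) % M   ≈⟨ %-≈ _ ⟩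
      i * (M′ * i * k % M)       ≈⟨ *-congˡ i (%-≈ _) ⟩
      i * (M′ * i * k)           ≡⟨ identity i M′ k ⟩
      M′ * i * i * k             ≈⟨ *-congʳ k -[i²]≈1 ⟩
      1 * k                      ≡⟨ *-identityˡ k ⟩
      k                          ∎)
      where
      identity : ∀ a b c → a * (b * a * c) ≡ b * a * a * c
      identity = solve-∀

    τσ : ∀ k → k < M → τ (σ k) ≡ k
    τσ k k<M = ≈⇒≡ (τ< (σ k) (σ< k k<M)) k<M (begin
      M′ * i * (i * k % M) % M   ≈⟨ %-≈ _ ⟩
      M′ * i * (i * k % M)       ≈⟨ *-congˡ (M′ * i) (%-≈ _) ⟩
      M′ * i * (i * k)           ≡⟨ identity i M′ k ⟩
      M′ * i * i * k             ≈⟨ *-congʳ k -[i²]≈1 ⟩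
      1 * k                      ≡⟨ *-identityˡ k ⟩
      k                          ∎)
      where
      identity : ∀ a b c → b * a * (a * c) ≡ b * a * a * c
      identity = solve-∀

    sq%∘σ : ∀ k → sq% M (σ k) ≡ M′ * sq% M k % M
    sq%∘σ k = ≈⇒%≡ (begin
      (i * k % M) * (i * k % M)  ≈⟨ *-cong (%-≈ (i * k)) (%-≈ (i * k)) ⟩
      (i * k) * (i * k)          ≡⟨ identity i k ⟩
      (i * i) * (k * k)          ≈⟨ *-cong i²≈-1 (≈-sym (%-≈ (k * k))) ⟩
      M′ * sq% M k               ∎)
      where
      identity : ∀ a b → (a * b) * (a * b) ≡ (a * a) * (b * b)
      identity = solve-∀

  -- The residue r of k² is sent to -r by multiplication with a square root of -1, and
  -- r + (-r mod M) = M unless r = 0.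
  Σ-sq%-root-of-minus-one : ∀ M′ {i} → suc M′ ∣ i * i + 1 →
    2 * Σ< (suc M′) (sq% (suc M′)) + suc M′ * zeroSquares (suc M′) ≡ suc M′ * suc M′
  Σ-sq%-root-of-minus-one M′ {i} M∣i²+1 = begin
    2 * Σ< M R + M * Σ< M Z                       ≡⟨ cong (λ x → Σ< M R + x + M * Σ< M Z) (+-identityʳ (Σ< M R)) ⟩
    Σ< M R + Σ< M R + M * Σ< M Z                  ≡⟨ cong (λ x → Σ< M R + x + M * Σ< M Z) (Σ-permute M σ τ σ< τ< στ τσ R) ⟨
    Σ< M R + Σ< M (λ k → R (σ k)) + M * Σ< M Z    ≡⟨ cong (λ x → Σ< M R + x + M * Σ< M Z) (Σ-cong M (λ k _ → sq%∘σ k)) ⟩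
    Σ< M R + Σ< M R⁻ + M * Σ< M Z                 ≡⟨ cong₂ _+_ (Σ-distrib-+ M R R⁻) (Σ-*ˡ M M Z) ⟨
    Σ< M (λ k → R k + R⁻ k) + Σ< M (λ k → M * Z k) ≡⟨ Σ-distrib-+ M (λ k → R k + R⁻ k) (λ k → M * Z k) ⟨
    Σ< M (λ k → R k + R⁻ k + M * Z k)             ≡⟨ Σ-cong M (λ k _ → residue+negation M′ {R k} (m%n<n (k * k) M)) ⟩
    Σ< M (λ _ → M)                                ≡⟨ Σ-const M M ⟩
    M * M                                         ∎
    where
    open ≡-Reasoning
    open MultiplicationByRootOfMinusOne M′ i M∣i²+1
    R R⁻ Z : ℕ → ℕ
    R    = sq% M
    R⁻ k = M′ * R k % M
    Z  k = χ (R k ≟ 0)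


module SquareDivisors where

  open import Data.Nat
  open import Data.Nat.Properties
  open import Data.Nat.DivMod
  open import Data.Nat.Divisibility
  open import Data.Nat.GCD using (gcd[m,n]∣m; gcd[m,n]∣n; gcd[m,n]≢0)
  open import Data.Nat.Coprimality using (Coprime; coprime-/gcd; coprime-divisor)
  import Data.Nat.Coprimality as Coprimality
  open import Data.Nat.Primality using (Prime; euclidsLemma; prime⇒irreducible; prime[2])
  open import Data.Nat.Tactic.RingSolver using (solve-∀)
  open import Data.Product using (_,_)
  open import Data.Sum using (inj₁; inj₂; reduce)
  open import Data.Empty using (⊥-elim)
  open import Relation.Nullary using (¬_)
  open import Relation.Binary.PropositionalEquality
  open ≡-Reasoning
  open import Defs using (SquareFree)
  open FiniteSums
  open SquareResidues using (zeroSquares)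

  prime∤⇒coprime : ∀ {p m} → Prime p → ¬ p ∣ m → Coprime p m
  prime∤⇒coprime pr p∤m {i} (i∣p , i∣m) with prime⇒irreducible pr i∣p
  ... | inj₁ i≡1 = i≡1
  ... | inj₂ refl = ⊥-elim (p∤m i∣m)

  coprime-*-∣ : ∀ {a b k} → Coprime a b → a ∣ k → b ∣ k → a * b ∣ k
  coprime-*-∣ {a} {b} cop (divides c refl) b∣ca =
    subst (a * b ∣_) (*-comm a c) (*-monoʳ-∣ a (coprime-divisor (Coprimality.sym cop) (subst (b ∣_) (*-comm c a) b∣ca)))

  record GcdSplit (m n : ℕ) : Set where
    field
      g a b   : ℕ
      m≡a*g   : m ≡ a * g
      n≡b*g   : n ≡ b * g
      .{{g≢0}} : NonZero g
      coprime : Coprime a b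

  gcdSplit : ∀ m n .{{_ : NonZero m}} → GcdSplit m n
  gcdSplit m n = record
    { m≡a*g = sym (m/n*n≡m (gcd[m,n]∣m m n)) ; n≡b*g = sym (m/n*n≡m (gcd[m,n]∣n m n)) ; coprime = coprime-/gcd m n }
    where instance _ = ≢-nonZero (gcd[m,n]≢0 m n (inj₁ (≢-nonZero⁻¹ m)))

  gcdSplit-∣ : ∀ {m n} (s : GcdSplit m n) → GcdSplit.a s ≡ 1 → m ∣ n
  gcdSplit-∣ record { g = g ; a = a ; b = b ; m≡a*g = refl ; n≡b*g = refl } refl =
    subst (_∣ b * g) (sym (*-identityˡ g)) (n∣m*n b)

  square-∣-square⇒∣ : ∀ Q k .{{_ : NonZero Q}} → Q * Q ∣ k * k → Q ∣ k
  square-∣-square⇒∣ Q k Q²∣k² with gcdSplit Q k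
  ... | s@record { g = g ; a = a ; b = b ; m≡a*g = refl ; n≡b*g = refl ; coprime = cop } =
    gcdSplit-∣ s (cop (∣-refl , coprime-divisor cop (∣-trans (m∣m*n a) a²∣b²)))
    where
    instance _ = m*n≢0 g g
    regroup : ∀ a g → (a * g) * (a * g) ≡ (a * a) * (g * g)
    regroup = solve-∀
    a²∣b² : a * a ∣ b * b
    a²∣b² = *-cancelʳ-∣ (g * g) (subst₂ _∣_ (regroup a g) (regroup b g) Q²∣k²)

  squarefree-∣-square⇒∣ : ∀ P x .{{_ : NonZero P}} → SquareFree P → P ∣ x * x → P ∣ x
  squarefree-∣-square⇒∣ P x sf P∣x² with gcdSplit P x
  ... | s@record { g = g ; a = a ; b = b ; m≡a*g = refl ; n≡b*g = refl ; coprime = cop } =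
    gcdSplit-∣ s (sf a (*-monoʳ-∣ a a∣g))
    where
    regroup : ∀ b g → (b * g) * (b * g) ≡ b * (b * g) * g
    regroup = solve-∀
    a∣g : a ∣ g
    a∣g = coprime-divisor cop (coprime-divisor cop (*-cancelʳ-∣ g (subst (a * g ∣_) (regroup b g) P∣x²)))

  squarefree*square-∣-square⇒∣ : ∀ P Q k .{{_ : NonZero P}} .{{_ : NonZero Q}} → SquareFree P →
                                 P * (Q * Q) ∣ k * k → P * Q ∣ k
  squarefree*square-∣-square⇒∣ P Q k sf PQ²∣k² with square-∣-square⇒∣ Q k (m*n∣⇒n∣ P (Q * Q) PQ²∣k²)
  ... | divides c refl = *-monoˡ-∣ Q (squarefree-∣-square⇒∣ P c sf P∣c²)
    where
    instance _ = m*n≢0 Q Q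
    regroup : ∀ c q → (c * q) * (c * q) ≡ c * c * (q * q)
    regroup = solve-∀
    P∣c² : P ∣ c * c
    P∣c² = *-cancelʳ-∣ (Q * Q) (subst (P * (Q * Q) ∣_) (regroup c Q) PQ²∣k²)

  Σ-χ-∣ : ∀ d Q .{{_ : NonZero d}} → Σ< (d * Q) (λ k → χ (d ∣? k)) ≡ Q
  Σ-χ-∣ d zero = cong (λ x → Σ< x (λ k → χ (d ∣? k))) (*-zeroʳ d)
  Σ-χ-∣ d@(suc d′) (suc Q) = begin
    Σ< (d * suc Q) (λ k → χ (d ∣? k))                                 ≡⟨ cong (λ x → Σ< x (λ k → χ (d ∣? k))) (*-suc d Q) ⟩
    Σ< (d + d * Q) (λ k → χ (d ∣? k))                                 ≡⟨ Σ-split d (d * Q) (λ k → χ (d ∣? k)) ⟩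
    Σ< d (λ k → χ (d ∣? k)) + Σ< (d * Q) (λ k → χ (d ∣? (d + k)))     ≡⟨ cong₂ _+_ first-block (Σ-cong (d * Q) shift) ⟩
    1 + Σ< (d * Q) (λ k → χ (d ∣? k))                                 ≡⟨ cong suc (Σ-χ-∣ d Q) ⟩
    suc Q                                                             ∎
    where
    first-block : Σ< d (λ k → χ (d ∣? k)) ≡ 1
    first-block = cong₂ _+_ (χ-yes (d ∣? 0) (d ∣0))
      (trans (Σ-cong d′ (λ k k<d′ → χ-no (d ∣? suc k) (λ d∣ → <⇒≱ (s≤s k<d′) (∣⇒≤ d∣)))) (Σ-zero d′))
    shift : ∀ k → k < d * Q → χ (d ∣? (d + k)) ≡ χ (d ∣? k)
    shift k _ = χ-cong (d ∣? (d + k)) (d ∣? k) (λ d∣d+k → ∣m+n∣m⇒∣n d∣d+k ∣-refl) (∣m∣n⇒∣m+n ∣-refl)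

  Σ-χ-∣-square : ∀ m D Q .{{_ : NonZero m}} .{{_ : NonZero D}} → m ≡ D * Q →
                 m ∣ D * D → (∀ k → m ∣ k * k → D ∣ k) → zeroSquares m ≡ Q
  Σ-χ-∣-square m D Q refl m∣D² m∣k²⇒D∣k = trans (Σ-cong m (λ k _ → χ-cong _ (D ∣? k) ⇒ ⇐)) (Σ-χ-∣ D Q)
    where
    ⇒ : ∀ {k} → k * k % m ≡ 0 → D ∣ k
    ⇒ {k} r≡0 = m∣k²⇒D∣k k (m%n≡0⇒n∣m (k * k) m r≡0)
    ⇐ : ∀ {k} → D ∣ k → k * k % m ≡ 0
    ⇐ {k} D∣k = n∣m⇒m%n≡0 (k * k) m (∣-trans m∣D² (*-pres-∣ D∣k D∣k))

  zeroSquares-squarefree*square : ∀ {m} P Q .{{_ : NonZero m}} → SquareFree P → m ≡ P * (Q * Q) → zeroSquares m ≡ Q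
  zeroSquares-squarefree*square {m} P Q sf m≡PQ² = Σ-χ-∣-square m (P * Q) Q m≡PQ*Q m∣[PQ]² m∣k²⇒PQ∣k
    where
    regroup : ∀ P Q → P * (Q * Q) ≡ P * Q * Q
    regroup = solve-∀
    m≡PQ*Q : m ≡ P * Q * Q
    m≡PQ*Q = trans m≡PQ² (regroup P Q)
    PQ²≢0 : NonZero (P * Q * Q)
    PQ²≢0 = ≢-nonZero (λ PQ²≡0 → ≢-nonZero⁻¹ m (trans m≡PQ*Q PQ²≡0))
    instance
      PQ≢0 : NonZero (P * Q)
      PQ≢0 = m*n≢0⇒m≢0 (P * Q) {{PQ²≢0}}
      P≢0 : NonZero P
      P≢0 = m*n≢0⇒m≢0 P {{PQ≢0}}
      Q≢0 : NonZero Q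
      Q≢0 = m*n≢0⇒n≢0 P {{PQ≢0}}
    m∣[PQ]² : m ∣ P * Q * (P * Q)
    m∣[PQ]² = subst (_∣ P * Q * (P * Q)) (sym m≡PQ*Q) (*-monoʳ-∣ (P * Q) (n∣m*n P))
    m∣k²⇒PQ∣k : ∀ k → m ∣ k * k → P * Q ∣ k
    m∣k²⇒PQ∣k k m∣k² = squarefree*square-∣-square⇒∣ P Q k sf (subst (_∣ k * k) m≡PQ² m∣k²)

  zeroSquares-2*squarefree*square : ∀ {m} P Q .{{_ : NonZero m}} → SquareFree P → ¬ 2 ∣ P * (Q * Q) →
                                    m ≡ 2 * (P * (Q * Q)) → zeroSquares m ≡ Q
  zeroSquares-2*squarefree*square {m} P Q sf 2∤PQ² m≡2PQ² = Σ-χ-∣-square m (2 * (P * Q)) Q m≡2PQ*Q m∣[2PQ]² m∣k²⇒2PQ∣k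
    where
    regroup : ∀ P Q → 2 * (P * (Q * Q)) ≡ 2 * (P * Q) * Q
    regroup = solve-∀
    regroup′ : ∀ P Q → 2 * (P * (Q * Q)) * (2 * P) ≡ 2 * (P * Q) * (2 * (P * Q))
    regroup′ = solve-∀
    m≡2PQ*Q : m ≡ 2 * (P * Q) * Q
    m≡2PQ*Q = trans m≡2PQ² (regroup P Q)
    2PQ²≢0 : NonZero (2 * (P * Q) * Q)
    2PQ²≢0 = ≢-nonZero (λ 2PQ²≡0 → ≢-nonZero⁻¹ m (trans m≡2PQ*Q 2PQ²≡0))
    instance
      2PQ≢0 : NonZero (2 * (P * Q))
      2PQ≢0 = m*n≢0⇒m≢0 (2 * (P * Q)) {{2PQ²≢0}}
      PQ≢0 : NonZero (P * Q)
      PQ≢0 = m*n≢0⇒n≢0 2 {{2PQ≢0}}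
      P≢0 : NonZero P
      P≢0 = m*n≢0⇒m≢0 P {{PQ≢0}}
      Q≢0 : NonZero Q
      Q≢0 = m*n≢0⇒n≢0 P {{PQ≢0}}
    m∣[2PQ]² : m ∣ 2 * (P * Q) * (2 * (P * Q))
    m∣[2PQ]² = subst₂ _∣_ (sym m≡2PQ²) (regroup′ P Q) (m∣m*n (2 * P))
    2∤PQ : ¬ 2 ∣ P * Q
    2∤PQ 2∣PQ = 2∤PQ² (∣-trans 2∣PQ (subst (P * Q ∣_) (*-assoc P Q Q) (m∣m*n Q)))
    m∣k²⇒2PQ∣k : ∀ k → m ∣ k * k → 2 * (P * Q) ∣ k
    m∣k²⇒2PQ∣k k m∣k² = coprime-*-∣ (prime∤⇒coprime prime[2] 2∤PQ)
      (reduce (euclidsLemma k k prime[2] (m*n∣⇒m∣ 2 (P * (Q * Q)) 2PQ²∣k²)))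
      (squarefree*square-∣-square⇒∣ P Q k sf (m*n∣⇒n∣ 2 (P * (Q * Q)) 2PQ²∣k²))
      where
      2PQ²∣k² : 2 * (P * (Q * Q)) ∣ k * k
      2PQ²∣k² = subst (_∣ k * k) m≡2PQ² m∣k²


module RootOfMinusOne where

  open import Data.Nat
  open import Data.Nat.Properties
  open import Data.Nat.DivMod
  open import Data.Nat.Divisibility
  open import Data.Nat.GCD using (module Bézout)
  open import Data.Nat.Coprimality using (coprime-Bézout; prime⇒coprime)
  open import Data.Nat.Primality using (Prime; euclidsLemma; prime⇒nonTrivial; prime⇒nonZero; prime[2])
  open import Data.Nat.Tactic.RingSolver using (solve-∀)
  open import Data.Fin using (Fin; toℕ; fromℕ<)
  open import Data.Fin.Properties using (any?; toℕ-fromℕ<)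
  open import Data.List using (List; []; _∷_)
  open import Data.Nat.ListAction using (product)
  open import Data.List.Relation.Unary.All using (All; []; _∷_)
  open import Data.Product using (_×_; _,_; proj₁; proj₂; ∃-syntax)
  open import Data.Sum using (_⊎_; inj₁; inj₂)
  open import Data.Empty using (⊥-elim)
  open import Relation.Nullary using (yes; no; ¬_)
  open import Relation.Binary.PropositionalEquality as ≡ using (_≡_; cong; subst)
  open FiniteSums
  open SquareDivisors using (prime∤⇒coprime; coprime-*-∣)

  -- Pairs a ∈ [1, h] with the unique b ∈ [1, h] such that a b ≡ ±1 modulo the prime 2h + 1.
  module Pairing (h : ℕ) (prime : Prime (suc (2 * h))) where

    p : ℕ
    p = suc (2 * h)

    open Congruence p
    open ≈-Reasoning

    ±Inverse : ℕ → ℕ → Set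
    ±Inverse a b = a * b ≈ 1 ⊎ a * b + 1 ≈ 0

    ±Inverse-sym : ∀ {a b} → ±Inverse a b → ±Inverse b a
    ±Inverse-sym {a} {b} (inj₁ ab≈1)   = inj₁ (≈-trans (≈-reflexive (*-comm b a)) ab≈1)
    ±Inverse-sym {a} {b} (inj₂ ab+1≈0) = inj₂ (≈-trans (≈-reflexive (cong (_+ 1) (*-comm b a))) ab+1≈0)

    ±Inverse-cong : ∀ a {b c} → b ≈ c → ±Inverse a b → ±Inverse a c
    ±Inverse-cong a b≈c (inj₁ ab≈1)   = inj₁ (≈-trans (*-congˡ a (≈-sym b≈c)) ab≈1)
    ±Inverse-cong a b≈c (inj₂ ab+1≈0) = inj₂ (≈-trans (+-congʳ 1 (*-congˡ a (≈-sym b≈c))) ab+1≈0)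

    ≤h⇒<p : ∀ {a} → a ≤ h → a < p
    ≤h⇒<p a≤h = s≤s (≤-trans a≤h (m≤m+n h (h + 0)))

    ≤h⇒+<p : ∀ {a b} → a ≤ h → b ≤ h → a + b < p
    ≤h⇒+<p a≤h b≤h = s≤s (≤-trans (+-mono-≤ a≤h b≤h) (≤-reflexive (cong (h +_) (≡.sym (+-identityʳ h)))))

    ≉0 : ∀ {a} → 0 < a → a < p → ¬ a ≈ 0
    ≉0 {suc a} _ a<p a≈0 = 1+n≢0 (≡.trans (≡.sym (m<n⇒m%n≡m a<p)) (≈⇒%≡ a≈0))

    ±Inverse-unique : ∀ {a b b′} → ±Inverse a b → ±Inverse a b′ →
                      0 < b → b ≤ h → 0 < b′ → b′ ≤ h → b ≡ b′
    ±Inverse-unique {a} {b} {b′} (inj₁ ab≈1) (inj₁ ab′≈1) _ b≤h _ b′≤h = ≈⇒≡ (≤h⇒<p b≤h) (≤h⇒<p b′≤h) (begin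
      b              ≡⟨ *-identityʳ b ⟨
      b * 1          ≈⟨ *-congˡ b ab′≈1 ⟨
      b * (a * b′)   ≡⟨ identity a b b′ ⟩
      a * b * b′     ≈⟨ *-congʳ b′ ab≈1 ⟩
      1 * b′         ≡⟨ *-identityˡ b′ ⟩
      b′             ∎)
      where
      identity : ∀ a b c → b * (a * c) ≡ a * b * c
      identity = solve-∀
    ±Inverse-unique {a} {b} {b′} (inj₂ ab+1≈0) (inj₂ ab′+1≈0) _ b≤h _ b′≤h =
      ≈⇒≡ (≤h⇒<p b≤h) (≤h⇒<p b′≤h) (+-cancelʳ (a * b * b′) (begin
        b + a * b * b′      ≡⟨ identity a b b′ ⟩
        (a * b′ + 1) * b    ≈⟨ *-congʳ b ab′+1≈0 ⟩
        0                   ≈⟨ *-congʳ b′ ab+1≈0 ⟨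
        (a * b + 1) * b′    ≡⟨ identity a b′ b ⟨
        b′ + a * b′ * b     ≡⟨ cong (b′ +_) (identity′ a b b′) ⟩
        b′ + a * b * b′     ∎))
      where
      identity : ∀ a b c → b + a * b * c ≡ (a * c + 1) * b
      identity = solve-∀
      identity′ : ∀ a b c → a * c * b ≡ a * b * c
      identity′ = solve-∀
    ±Inverse-unique {a} {b} {b′} (inj₁ ab≈1) (inj₂ ab′+1≈0) 0<b b≤h _ b′≤h =
      ⊥-elim (≉0 (≤-trans 0<b (m≤n+m b b′)) (≤h⇒+<p b′≤h b≤h) (begin
        b′ + b              ≡⟨ cong (_+ b) (*-identityʳ b′) ⟨
        b′ * 1 + b          ≈⟨ +-congʳ b (*-congˡ b′ ab≈1) ⟨
        b′ * (a * b) + b    ≡⟨ identity a b b′ ⟩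
        (a * b′ + 1) * b    ≈⟨ *-congʳ b ab′+1≈0 ⟩
        0                   ∎))
      where
      identity : ∀ a b c → c * (a * b) + b ≡ (a * c + 1) * b
      identity = solve-∀
    ±Inverse-unique {a} (inj₂ ab+1≈0) (inj₁ ab′≈1) 0<b b≤h 0<b′ b′≤h =
      ≡.sym (±Inverse-unique {a} (inj₁ ab′≈1) (inj₂ ab+1≈0) 0<b′ b′≤h 0<b b≤h)

    ±Inverse-mod : ∀ a → 0 < a → a < p → ∃[ b ] ±Inverse a b
    ±Inverse-mod a@(suc _) _ a<p with coprime-Bézout (prime⇒coprime prime a<p)
    ... | Bézout.+- x y 1+ya≡xp = y , inj₂ (begin
      a * y + 1    ≡⟨ ≡.trans (+-comm (a * y) 1) (cong (1 +_) (*-comm a y)) ⟩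
      1 + y * a    ≡⟨ 1+ya≡xp ⟩
      x * p        ≈⟨ *M≈0 x ⟩
      0            ∎)
    ... | Bézout.-+ x y 1+xp≡ya = y , inj₁ (begin
      a * y        ≡⟨ ≡.trans (*-comm a y) (≡.sym 1+xp≡ya) ⟩
      1 + x * p    ≈⟨ +-*M-≈ 1 x ⟩
      1            ∎)

    *[p∸b]+*b≈0 : ∀ a {b} → b ≤ p → a * (p ∸ b) + a * b ≈ 0
    *[p∸b]+*b≈0 a {b} b≤p = begin
      a * (p ∸ b) + a * b   ≡⟨ *-distribˡ-+ a (p ∸ b) b ⟨
      a * (p ∸ b + b)       ≡⟨ cong (a *_) (m∸n+n≡m b≤p) ⟩
      a * p                 ≈⟨ *M≈0 a ⟩
      0                     ∎

    ±Inverse-negate : ∀ a {b} → b ≤ p → ±Inverse a b → ±Inverse a (p ∸ b)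
    ±Inverse-negate a {b} b≤p (inj₁ ab≈1)   = inj₂ (≈-trans (+-congˡ (a * (p ∸ b)) (≈-sym ab≈1)) (*[p∸b]+*b≈0 a b≤p))
    ±Inverse-negate a {b} b≤p (inj₂ ab+1≈0) = inj₁ (+-cancelʳ (a * b + 1) (begin
      a * (p ∸ b) + (a * b + 1)    ≡⟨ +-assoc (a * (p ∸ b)) (a * b) 1 ⟨
      a * (p ∸ b) + a * b + 1      ≈⟨ +-congʳ 1 (*[p∸b]+*b≈0 a b≤p) ⟩
      1                            ≈⟨ +-congˡ 1 ab+1≈0 ⟨
      1 + (a * b + 1)              ∎))

    ±Inverse-exists : ∀ a → 0 < a → a ≤ h → ∃[ b ] (0 < b × b ≤ h) × ±Inverse a b
    ±Inverse-exists a 0<a a≤h with ±Inverse-mod a 0<a (≤h⇒<p a≤h)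
    ... | y , ay≈±1 with y % p | m%n<n y p | ±Inverse-cong a (≈-sym (%-≈ y)) ay≈±1
    ...   | zero  | _   | a0≈±1 = ⊥-elim (not-±Inverse-0 a0≈±1)
      where
      1≉0 : ¬ 1 ≈ 0
      1≉0 = ≉0 z<s (≤h⇒<p (≤-trans 0<a a≤h))
      not-±Inverse-0 : ¬ ±Inverse a 0
      not-±Inverse-0 (inj₁ a0≈1)   = 1≉0 (≈-trans (≈-sym a0≈1) (≈-reflexive (*-zeroʳ a)))
      not-±Inverse-0 (inj₂ a0+1≈0) = 1≉0 (≈-trans (≈-reflexive (cong (_+ 1) (≡.sym (*-zeroʳ a)))) a0+1≈0)
    ...   | suc b | 1+b<p | a[1+b]≈±1 with suc b ≤? h
    ...     | yes 1+b≤h = suc b , (z<s , 1+b≤h) , a[1+b]≈±1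
    ...     | no  1+b≰h = p ∸ suc b , (m<n⇒0<n∸m 1+b<p , p∸[1+b]≤h) , ±Inverse-negate a (<⇒≤ 1+b<p) a[1+b]≈±1
      where
      p∸[1+b]≤h : p ∸ suc b ≤ h
      p∸[1+b]≤h = ≤-trans (∸-monoʳ-≤ p (≰⇒> 1+b≰h)) (≤-reflexive (≡.trans (m+n∸m≡n h (h + 0)) (+-identityʳ h)))

    square≈1⇒≡1 : ∀ a → 0 < a → a ≤ h → a * a ≈ 1 → a ≡ 1
    square≈1⇒≡1 (suc a) _ 1+a≤h a²≈1 with euclidsLemma a (2 + a) prime (≈0⇒∣ (+-cancelʳ 1 (begin
      a * (2 + a) + 1        ≡⟨ identity a ⟩
      suc a * suc a          ≈⟨ a²≈1 ⟩
      1                      ∎)))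
      where
      identity : ∀ a → a * (2 + a) + 1 ≡ suc a * suc a
      identity = solve-∀
    ... | inj₂ p∣2+a = ⊥-elim (<⇒≱ (≤h⇒+<p (≤-trans z<s 1+a≤h) 1+a≤h) (∣⇒≤ p∣2+a))
    ... | inj₁ p∣a with a
    ...   | zero   = ≡.refl
    ...   | suc a′ = ⊥-elim (<⇒≱ (≤h⇒<p (≤-trans (n≤1+n _) 1+a≤h)) (∣⇒≤ p∣a))

    -- partner acts on a ∈ [0, h), standing for a + 1 ∈ [1, h].
    partner : ℕ → ℕ
    partner a with a <? h
    ... | yes a<h = pred (proj₁ (±Inverse-exists (suc a) z<s a<h))
    ... | no  _   = a

    partner-spec : ∀ a → a < h → partner a < h × ±Inverse (suc a) (suc (partner a))
    partner-spec a a<h with a <? h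
    ... | no a≮h   = ⊥-elim (a≮h a<h)
    ... | yes a<h′ with ±Inverse-exists (suc a) z<s a<h′
    ...   | suc b , (_ , 1+b≤h) , a·b≈±1 = 1+b≤h , a·b≈±1

    partner< : ∀ a → a < h → partner a < h
    partner< a a<h = proj₁ (partner-spec a a<h)

    partner-involutive : ∀ a → a < h → partner (partner a) ≡ a
    partner-involutive a a<h = suc-injective (±Inverse-unique {suc b}
      (proj₂ (partner-spec b b<h)) (±Inverse-sym {suc a} (proj₂ (partner-spec a a<h))) z<s (partner< b b<h) z<s a<h)
      where
      b = partner a
      b<h = partner< a a<h

    partner-fixed : ∀ a → a < h → partner a ≡ a → a ≡ 0 ⊎ p ∣ suc a * suc a + 1
    partner-fixed a a<h e with subst (λ b → ±Inverse (suc a) (suc b)) e (proj₂ (partner-spec a a<h))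
    ... | inj₁ [1+a]²≈1   = inj₁ (suc-injective (square≈1⇒≡1 (suc a) z<s a<h [1+a]²≈1))
    ... | inj₂ [1+a]²+1≈0 = inj₂ (≈0⇒∣ [1+a]²+1≈0)

    partner-0 : 0 < h → partner 0 ≡ 0
    partner-0 0<h = suc-injective (±Inverse-unique {1} (proj₂ (partner-spec 0 0<h)) (inj₁ ≈-refl) z<s (partner< 0 0<h) z<s 0<h)

    -- Without a root of -1 the only fixed point of partner is 0, so h would be odd.
    root-of-minus-one : ∀ t → h ≡ 2 * t → ∃[ x ] p ∣ x * x + 1
    root-of-minus-one t h≡2t with any? (λ (i : Fin h) → p ∣? suc (toℕ i) * suc (toℕ i) + 1)
    ... | yes (i , p∣[1+i]²+1) = suc (toℕ i) , p∣[1+i]²+1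
    ... | no ∄i = ⊥-elim (even≢odd t X (≡.trans (≡.sym h≡2t) (≡.trans
            (≡.sym (involution-parity h partner partner< partner-involutive))
            (cong (_+ 2 * X) one-fixed-point))))
      where
      X : ℕ
      X = Σ< h (λ a → χ (a <? partner a))

      0<h : 0 < h
      0<h = n≢0⇒n>0 (λ h≡0 → <⇒≱ (nonTrivial⇒n>1 p {{prime⇒nonTrivial prime}}) (≤-reflexive (cong (λ x → suc (2 * x)) h≡0)))

      no-root : ∀ a → a < h → ¬ p ∣ suc a * suc a + 1
      no-root a a<h p∣ = ∄i (fromℕ< a<h , subst (λ x → p ∣ suc x * suc x + 1) (≡.sym (toℕ-fromℕ< a<h)) p∣)

      fixed⇒0 : ∀ a → a < h → partner a ≡ a → a ≡ 0
      fixed⇒0 a a<h e with partner-fixed a a<h e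
      ... | inj₁ a≡0 = a≡0
      ... | inj₂ p∣  = ⊥-elim (no-root a a<h p∣)

      one-fixed-point : Σ< h (λ a → χ (partner a ≟ a)) ≡ 1
      one-fixed-point = ≡.trans (Σ-cong h (λ a a<h → χ-cong (partner a ≟ a) (a ≟ 0) (fixed⇒0 a a<h) (λ { ≡.refl → partner-0 0<h })))
                                (only-zero h 0<h)
        where
        only-zero : ∀ n → 0 < n → Σ< n (λ a → χ (a ≟ 0)) ≡ 1
        only-zero (suc n) _ = cong suc (Σ-zero n)

  prime∤⇒negated-inverse : ∀ {p a} → Prime p → ¬ p ∣ a → ∃[ w ] p ∣ a * w + 1
  prime∤⇒negated-inverse {zero} pr _ = ⊥-elim (≢-nonZero⁻¹ 0 {{prime⇒nonZero pr}} ≡.refl)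
  prime∤⇒negated-inverse {p@(suc q)} {a} pr p∤a with coprime-Bézout (prime∤⇒coprime pr p∤a)
  ... | Bézout.+- x y 1+ya≡xp = y , divides x (≡.trans (identity a y) 1+ya≡xp)
    where
    identity : ∀ a y → a * y + 1 ≡ 1 + y * a
    identity = solve-∀
  ... | Bézout.-+ x y 1+xp≡ya = y * q , divides (1 + x * q) (begin
    a * (y * q) + 1              ≡⟨ identity a y q ⟩
    y * a * q + 1                ≡⟨ cong (λ z → z * q + 1) 1+xp≡ya ⟨
    (1 + x * p) * q + 1          ≡⟨ identity′ x q ⟩
    (1 + x * q) * p              ∎)
    where
    open ≡.≡-Reasoning
    identity : ∀ a y q → a * (y * q) + 1 ≡ y * a * q + 1
    identity = solve-∀
    identity′ : ∀ x q → (1 + x * suc q) * q + 1 ≡ (1 + x * q) * suc q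
    identity′ = solve-∀

  ∤2*root : ∀ {p x} → Prime p → ¬ p ∣ 2 → p ∣ x * x + 1 → ¬ p ∣ 2 * x
  ∤2*root {p} {x} pr p∤2 p∣x²+1 p∣2x with euclidsLemma 2 x pr p∣2x
  ... | inj₁ p∣2 = p∤2 p∣2
  ... | inj₂ p∣x = <⇒≢ (nonTrivial⇒n>1 p {{prime⇒nonTrivial pr}}) (≡.sym (∣1⇒≡1 (∣m+n∣m⇒∣n p∣x²+1 (∣m⇒∣m*n x p∣x))))

  -- z = x + M c w, where x² + 1 = c M and 2 x w ≡ -1 (mod p).
  hensel-lift : ∀ {p M x} → Prime p → ¬ p ∣ 2 → p ∣ M → M ∣ x * x + 1 → ∃[ z ] p * M ∣ z * z + 1
  hensel-lift {p} {M} {x} pr p∤2 p∣M@(divides M₀ ≡.refl) M∣x²+1@(divides c x²+1≡cM)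
    with prime∤⇒negated-inverse pr (∤2*root {x = x} pr p∤2 (∣-trans p∣M M∣x²+1))
  ... | w , divides k 2xw+1≡kp = x + M * (c * w) , divides (c * k + M₀ * (c * w) * (c * w)) (begin
    (x + M * (c * w)) * (x + M * (c * w)) + 1                  ≡⟨ expand x M (c * w) ⟩
    (x * x + 1) + M * (c * w) * (2 * x) + M * M * (c * w) * (c * w)
                                                               ≡⟨ cong (λ e → e + M * (c * w) * (2 * x) + M * M * (c * w) * (c * w)) x²+1≡cM ⟩
    c * M + M * (c * w) * (2 * x) + M * M * (c * w) * (c * w)  ≡⟨ factor c M w x ⟩
    c * M * (2 * x * w + 1) + M * M * (c * w) * (c * w)        ≡⟨ cong (λ e → c * M * e + M * M * (c * w) * (c * w)) 2xw+1≡kp ⟩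
    c * M * (k * p) + M * M * (c * w) * (c * w)                ≡⟨ regroup c k M₀ p w ⟩
    (c * k + M₀ * (c * w) * (c * w)) * (p * M)                 ∎)
    where
    open ≡.≡-Reasoning
    expand : ∀ x m s → (x + m * s) * (x + m * s) + 1 ≡ (x * x + 1) + m * s * (2 * x) + m * m * s * s
    expand = solve-∀
    factor : ∀ c m w x → c * m + m * (c * w) * (2 * x) + m * m * (c * w) * (c * w)
                         ≡ c * m * (2 * x * w + 1) + m * m * (c * w) * (c * w)
    factor = solve-∀
    regroup : ∀ c k m₀ p w → c * (m₀ * p) * (k * p) + m₀ * p * (m₀ * p) * (c * w) * (c * w)
                             ≡ (c * k + m₀ * (c * w) * (c * w)) * (p * (m₀ * p))
    regroup = solve-∀

  -- z ≡ x (mod M) and, as M w ≡ -1 (mod p), z ≡ x - (x - y) = y (mod p).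
  crt-lift : ∀ {p M x y} → Prime p → ¬ p ∣ M → M ∣ x * x + 1 → p ∣ y * y + 1 →
             ∃[ z ] p * M ∣ z * z + 1
  crt-lift {p} {M} {x} {y} pr p∤M M∣x²+1 p∣y²+1 with prime∤⇒negated-inverse pr p∤M
  ... | w , p∣Mw+1 = z , coprime-*-∣ (prime∤⇒coprime pr p∤M) (P.∣-square+1-resp-≈ z≈y p∣y²+1) (Mod.∣-square+1-resp-≈ z≈x M∣x²+1)
    where
    instance
      _ = prime⇒nonZero pr
      _ = ≢-nonZero (λ M≡0 → m+1+n≢0 (x * x) (0∣⇒≡0 (subst (_∣ x * x + 1) M≡0 M∣x²+1)))
    module P = Congruence p
    module Mod = Congruence M
    c z : ℕ
    c = x + pred p * y
    z = x + M * (w * c)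

    z≈x : z Mod.≈ x
    z≈x = Mod.≈-trans (Mod.≈-reflexive (cong (x +_) (*-comm M (w * c)))) (Mod.+-*M-≈ x (w * c))

    z≈y : z P.≈ y
    z≈y = P.+-cancelʳ c (begin
      z + c                  ≡⟨ identity x M w c ⟩
      x + (M * w + 1) * c    ≈⟨ P.+-congˡ x (P.*-congʳ c (P.∣⇒≈0 p∣Mw+1)) ⟩
      x + 0                  ≡⟨ +-identityʳ x ⟩
      x                      ≈⟨ P.+-*M-≈ x y ⟨
      x + y * p              ≡⟨ cong (λ q → x + y * q) (suc-pred p) ⟨
      x + y * suc (pred p)   ≡⟨ identity′ x y (pred p) ⟩
      y + c                  ∎)
      where
      open P.≈-Reasoning
      identity : ∀ x m w c → x + m * (w * c) + c ≡ x + (m * w + 1) * c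
      identity = solve-∀
      identity′ : ∀ x y q → x + y * suc q ≡ y + (x + q * y)
      identity′ = solve-∀

  prime≡1mod4⇒root : ∀ {p} → Prime p → p % 4 ≡ 1 → ∃[ x ] p ∣ x * x + 1
  prime≡1mod4⇒root {p} pr p%4≡1 = transport (Pairing.root-of-minus-one (2 * t) (subst Prime p≡1+4t pr) t ≡.refl)
    where
    t = p / 4
    identity : ∀ t → 1 + t * 4 ≡ suc (2 * (2 * t))
    identity = solve-∀
    p≡1+4t : p ≡ suc (2 * (2 * t))
    p≡1+4t = ≡.trans (m≡m%n+[m/n]*n p 4) (≡.trans (cong (_+ t * 4) p%4≡1) (identity t))
    transport : ∃[ x ] suc (2 * (2 * t)) ∣ x * x + 1 → ∃[ x ] p ∣ x * x + 1
    transport (x , ∣x²+1) = x , subst (_∣ x * x + 1) (≡.sym p≡1+4t) ∣x²+1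

  ≡1mod4⇒∤2 : ∀ {p} → Prime p → p % 4 ≡ 1 → ¬ p ∣ 2
  ≡1mod4⇒∤2 {p} pr p%4≡1 p∣2 with ≤-antisym (∣⇒≤ p∣2) (nonTrivial⇒n>1 p {{prime⇒nonTrivial pr}})
  ... | ≡.refl with p%4≡1
  ... | ()

  product-root : ∀ ps → All (λ q → Prime q × q % 4 ≡ 1) ps → ∃[ x ] product ps ∣ x * x + 1
  product-root []       []                       = 0 , ∣-refl
  product-root (q ∷ ps) ((pr , q%4≡1) ∷ primes) with product-root ps primes | prime≡1mod4⇒root pr q%4≡1
  ... | x , M∣x²+1 | y , q∣y²+1 with q ∣? product ps
  ... | yes q∣M = hensel-lift {x = x} pr (≡1mod4⇒∤2 pr q%4≡1) q∣M M∣x²+1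
  ... | no  q∤M = crt-lift {x = x} {y} pr q∤M M∣x²+1 q∣y²+1

  2∤1+2* : ∀ r → ¬ 2 ∣ suc (2 * r)
  2∤1+2* r (divides k 1+2r≡k*2) = even≢odd k r (≡.trans (*-comm 2 k) (≡.sym 1+2r≡k*2))

  -- x + n (1 + x) is an odd root of -1 modulo the odd number n.
  double-root : ∀ {n} r {x} → n ≡ suc (2 * r) → n ∣ x * x + 1 → ∃[ z ] 2 * n ∣ z * z + 1
  double-root r {x} ≡.refl n∣x²+1 =
    z , coprime-*-∣ (prime∤⇒coprime prime[2] (2∤1+2* r)) 2∣z²+1 (∣-square+1-resp-≈ z≈x n∣x²+1)
    where
    open Congruence (suc (2 * r))
    n q z : ℕ
    n = suc (2 * r)
    q = x + r * (1 + x)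
    z = x + n * (1 + x)
    z≈x : z ≈ x
    z≈x = ≈-trans (≈-reflexive (cong (x +_) (*-comm n (1 + x)))) (+-*M-≈ x (1 + x))
    z≡1+2q : ∀ x r → x + suc (2 * r) * (1 + x) ≡ suc (2 * (x + r * (1 + x)))
    z≡1+2q = solve-∀
    odd²+1 : ∀ q → suc (2 * q) * suc (2 * q) + 1 ≡ (2 * q * q + 2 * q + 1) * 2
    odd²+1 = solve-∀
    2∣z²+1 : 2 ∣ z * z + 1
    2∣z²+1 = divides (2 * q * q + 2 * q + 1) (≡.trans (cong (λ y → y * y + 1) (z≡1+2q x r)) (odd²+1 q))


module SquareRootSum where

  open import Data.Nat
  open import Data.Nat.Properties
  open import Data.Nat.DivMod
  open import Data.Nat.Divisibility using (_∣_)
  open import Data.Nat.Tactic.RingSolver using (solve-∀)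
  open import Relation.Binary.PropositionalEquality
  open ≡-Reasoning
  open import Defs using (sqrtSum)
  open FiniteSums
  open LatticePoints
  open SquareResidues

  -- Eliminating H with the third identity and cancelling m in the second determines 12 C, hence S.
  odd-case-algebra : ∀ L S C H Z → let m = 1 + 4 * L; K = 2 * L in
    S + C ≡ L * K →
    6 * (m * C + H + m * Z) ≡ K * (K + 1) * (2 * K + 1) →
    2 * (2 * H) + m * (1 + 2 * Z) ≡ m * m →
    12 * S + 4 ≡ m * m + 3 * (1 + 2 * Z)
  odd-case-algebra L S C H Z S+C≡LK 6T≡ residues = +-cancelʳ-≡ X _ _ (begin
    12 * S + 4 + X                          ≡⟨ identity₁ S C Z L ⟩
    12 * (S + C) + 4 + 3 * m + 6 * Z        ≡⟨ cong (λ e → 12 * e + 4 + 3 * m + 6 * Z) S+C≡LK ⟩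
    12 * (L * K) + 4 + 3 * m + 6 * Z        ≡⟨ identity₂ L Z ⟩
    m * m + 3 * (1 + 2 * Z) + (2 * K * (K + 1) + 3) ≡⟨ cong (m * m + 3 * (1 + 2 * Z) +_) X≡ ⟨
    m * m + 3 * (1 + 2 * Z) + X             ∎)
    where
    m K X : ℕ
    m = 1 + 4 * L
    K = 2 * L
    X = 12 * C + 3 * m + 6 * Z
    identity₁ : ∀ S C Z L → 12 * S + 4 + (12 * C + 3 * (1 + 4 * L) + 6 * Z) ≡ 12 * (S + C) + 4 + 3 * (1 + 4 * L) + 6 * Z
    identity₁ = solve-∀
    identity₂ : ∀ L Z → 12 * (L * (2 * L)) + 4 + 3 * (1 + 4 * L) + 6 * Z
                        ≡ (1 + 4 * L) * (1 + 4 * L) + 3 * (1 + 2 * Z) + (2 * (2 * L) * (2 * L + 1) + 3)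
    identity₂ = solve-∀
    X≡ : X ≡ 2 * K * (K + 1) + 3
    X≡ = *-cancelˡ-≡ X _ m (begin
      m * (12 * C + 3 * m + 6 * Z)            ≡⟨ identity₃ m C Z ⟩
      12 * (m * C) + 3 * (m * m) + 6 * (m * Z) ≡⟨ cong (λ e → 12 * (m * C) + 3 * e + 6 * (m * Z)) residues ⟨
      12 * (m * C) + 3 * (2 * (2 * H) + m * (1 + 2 * Z)) + 6 * (m * Z)
                                              ≡⟨ identity₄ m C H Z ⟩
      2 * (6 * (m * C + H + m * Z)) + 3 * m   ≡⟨ cong (λ e → 2 * e + 3 * m) 6T≡ ⟩
      2 * (K * (K + 1) * (2 * K + 1)) + 3 * m ≡⟨ identity₅ L ⟩
      m * (2 * K * (K + 1) + 3)               ∎)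
      where
      identity₃ : ∀ m C Z → m * (12 * C + 3 * m + 6 * Z) ≡ 12 * (m * C) + 3 * (m * m) + 6 * (m * Z)
      identity₃ = solve-∀
      identity₄ : ∀ m C H Z → 12 * (m * C) + 3 * (2 * (2 * H) + m * (1 + 2 * Z)) + 6 * (m * Z) ≡ 2 * (6 * (m * C + H + m * Z)) + 3 * m
      identity₄ = solve-∀
      identity₅ : ∀ L → 2 * (2 * L * (2 * L + 1) * (2 * (2 * L) + 1)) + 3 * (1 + 4 * L) ≡ (1 + 4 * L) * (2 * (2 * L) * (2 * L + 1) + 3)
      identity₅ = solve-∀

  even-case-algebra : ∀ L S C H Z → let n = 1 + 4 * L; m = 2 * n; K = 4 * L in
    S + C ≡ (2 * L) * K →
    6 * (m * C + H + m * Z) ≡ K * (K + 1) * (2 * K + 1) →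
    2 * (n + 2 * H) + m * (1 + 2 * Z) ≡ m * m →
    12 * S + (3 * n + 4) ≡ m * m + 3 * (1 + 2 * Z)
  even-case-algebra L S C H Z S+C≡LK 6T≡ residues = +-cancelʳ-≡ X _ _ (begin
    12 * S + (3 * n + 4) + X                    ≡⟨ identity₁ S C Z L ⟩
    12 * (S + C) + 3 * n + 4 + 3 * m + 6 * Z    ≡⟨ cong (λ e → 12 * e + 3 * n + 4 + 3 * m + 6 * Z) S+C≡LK ⟩
    12 * (2 * L * K) + 3 * n + 4 + 3 * m + 6 * Z ≡⟨ identity₂ L Z ⟩
    m * m + 3 * (1 + 2 * Z) + (2 * K * K + K + 6) ≡⟨ cong (m * m + 3 * (1 + 2 * Z) +_) X≡ ⟨
    m * m + 3 * (1 + 2 * Z) + X                 ∎)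
    where
    n m K X : ℕ
    n = 1 + 4 * L
    m = 2 * n
    K = 4 * L
    X = 12 * C + 3 * m + 6 * Z
    identity₁ : ∀ S C Z L → 12 * S + (3 * (1 + 4 * L) + 4) + (12 * C + 3 * (2 * (1 + 4 * L)) + 6 * Z)
                            ≡ 12 * (S + C) + 3 * (1 + 4 * L) + 4 + 3 * (2 * (1 + 4 * L)) + 6 * Z
    identity₁ = solve-∀
    identity₂ : ∀ L Z → 12 * (2 * L * (4 * L)) + 3 * (1 + 4 * L) + 4 + 3 * (2 * (1 + 4 * L)) + 6 * Z
                        ≡ 2 * (1 + 4 * L) * (2 * (1 + 4 * L)) + 3 * (1 + 2 * Z) + (2 * (4 * L) * (4 * L) + 4 * L + 6)
    identity₂ = solve-∀
    X≡ : X ≡ 2 * K * K + K + 6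
    X≡ = *-cancelˡ-≡ X _ m (begin
      m * (12 * C + 3 * m + 6 * Z)             ≡⟨ identity₃ m C Z ⟩
      12 * (m * C) + 3 * (m * m) + 6 * (m * Z) ≡⟨ cong (λ e → 12 * (m * C) + 3 * e + 6 * (m * Z)) residues ⟨
      12 * (m * C) + 3 * (2 * (n + 2 * H) + m * (1 + 2 * Z)) + 6 * (m * Z)
                                               ≡⟨ identity₄ m n C H Z ⟩
      2 * (6 * (m * C + H + m * Z)) + 6 * n + 3 * m ≡⟨ cong (λ e → 2 * e + 6 * n + 3 * m) 6T≡ ⟩
      2 * (K * (K + 1) * (2 * K + 1)) + 6 * n + 3 * m ≡⟨ identity₅ L ⟩
      m * (2 * K * K + K + 6)                  ∎)
      where
      identity₃ : ∀ m C Z → m * (12 * C + 3 * m + 6 * Z) ≡ 12 * (m * C) + 3 * (m * m) + 6 * (m * Z)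
      identity₃ = solve-∀
      identity₄ : ∀ m n C H Z → 12 * (m * C) + 3 * (2 * (n + 2 * H) + m * (1 + 2 * Z)) + 6 * (m * Z)
                                ≡ 2 * (6 * (m * C + H + m * Z)) + 6 * n + 3 * m
      identity₄ = solve-∀
      identity₅ : ∀ L → 2 * (4 * L * (4 * L + 1) * (2 * (4 * L) + 1)) + 6 * (1 + 4 * L) + 3 * (2 * (1 + 4 * L))
                        ≡ 2 * (1 + 4 * L) * (2 * (4 * L) * (4 * L) + 4 * L + 6)
      identity₅ = solve-∀

  12*sqrtSum-odd : ∀ L {i} → 1 + 4 * L ∣ i * i + 1 →
    12 * sqrtSum (1 + 4 * L) + 4 ≡ (1 + 4 * L) * (1 + 4 * L) + 3 * zeroSquares (1 + 4 * L)
  12*sqrtSum-odd L {i} m∣i²+1 =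
    trans (odd-case-algebra L S C H Z lattice squares residues) (cong (λ q → m * m + 3 * q) (sym zeros))
    where
    m K S C H Z : ℕ
    m = 1 + 4 * L
    K = 2 * L
    S = sqrtSum m
    C = Σ< K (countBelow {m})
    H = Σ< K (λ k → sq% m (suc k))
    Z = Σ< K (λ k → χ (sq% m (suc k) ≟ 0))

    identity₁ : ∀ L → 1 + 4 * L ≡ 1 + L * 4
    identity₁ = solve-∀
    identity₂ : ∀ L → 1 + 4 * L ≡ suc (2 * L + 2 * L)
    identity₂ = solve-∀
    identity₃ : ∀ L → 2 * L * (2 * L) + L ≡ L * (1 + 4 * L)
    identity₃ = solve-∀
    identity₄ : ∀ L → L * (1 + 4 * L) + 3 * L ≡ 2 * L + 2 * L * (1 + 2 * L)
    identity₄ = solve-∀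

    lattice : S + C ≡ L * K
    lattice = sqrtSum-lattice-count L K (trans (cong (_/ 4) (identity₁ L)) (/-decomposition L (s≤s (s≤s z≤n))))
      (≤-trans (m≤m+n (K * K) L) (≤-reflexive (identity₃ L))) (s≤s (≤-trans (m≤m+n (L * m) (3 * L)) (≤-reflexive (identity₄ L))))

    squares : 6 * (m * C + H + m * Z) ≡ K * (K + 1) * (2 * K + 1)
    squares = trans (cong (6 *_) (Σ-pred-/-%-identity K)) (Σ-squares K)

    zeros : zeroSquares m ≡ 1 + 2 * Z
    zeros = Σ-reflect-odd m (λ k → χ (sq% m k ≟ 0)) (λ a b a+b≡m → cong (λ r → χ (r ≟ 0)) (sq%-reflect m a b a+b≡m)) K (identity₂ L)

    residues : 2 * (2 * H) + m * (1 + 2 * Z) ≡ m * m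
    residues = trans (cong₂ (λ R Z′ → 2 * R + m * Z′) (sym (Σ-reflect-odd m (sq% m) (sq%-reflect m) K (identity₂ L))) (sym zeros))
                     (Σ-sq%-root-of-minus-one (4 * L) {i} m∣i²+1)

  12*sqrtSum-even : ∀ L {i} → 2 * (1 + 4 * L) ∣ i * i + 1 →
    12 * sqrtSum (2 * (1 + 4 * L)) + (3 * (1 + 4 * L) + 4) ≡ (2 * (1 + 4 * L)) * (2 * (1 + 4 * L)) + 3 * zeroSquares (2 * (1 + 4 * L))
  12*sqrtSum-even L {i} m∣i²+1 =
    trans (even-case-algebra L S C H Z lattice squares residues) (cong (λ q → m * m + 3 * q) (sym zeros))
    where
    n m K S C H Z : ℕ
    n = 1 + 4 * L
    m = 2 * n
    K = 4 * L
    S = sqrtSum m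
    C = Σ< K (countBelow {m})
    H = Σ< K (λ k → sq% m (suc k))
    Z = Σ< K (λ k → χ (sq% m (suc k) ≟ 0))

    identity₁ : ∀ L → 2 * (1 + 4 * L) ≡ 2 + 2 * L * 4
    identity₁ = solve-∀
    identity₂ : ∀ L → 2 * (1 + 4 * L) ≡ suc (suc (4 * L + 4 * L))
    identity₂ = solve-∀
    identity₃ : ∀ L → 4 * L * (4 * L) + 4 * L ≡ 2 * L * (2 * (1 + 4 * L))
    identity₃ = solve-∀
    identity₄ : ∀ L → 2 * L * (2 * (1 + 4 * L)) + 4 * L ≡ 4 * L + 4 * L * suc (4 * L)
    identity₄ = solve-∀
    identity₅ : ∀ L → suc (4 * L) * suc (4 * L) ≡ (1 + 4 * L) + 2 * L * (2 * (1 + 4 * L))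
    identity₅ = solve-∀

    lattice : S + C ≡ (2 * L) * K
    lattice = sqrtSum-lattice-count (2 * L) K (trans (cong (_/ 4) (identity₁ L)) (/-decomposition (2 * L) (s≤s (s≤s (s≤s z≤n)))))
      (≤-trans (m≤m+n (K * K) (4 * L)) (≤-reflexive (identity₃ L))) (s≤s (≤-trans (m≤m+n (2 * L * m) (4 * L)) (≤-reflexive (identity₄ L))))

    squares : 6 * (m * C + H + m * Z) ≡ K * (K + 1) * (2 * K + 1)
    squares = trans (cong (6 *_) (Σ-pred-/-%-identity K)) (Σ-squares K)

    sq%-middle : sq% m (suc K) ≡ n
    sq%-middle = trans (cong (_% m) (identity₅ L)) (%-decomposition (2 * L) (≤-trans (≤-reflexive (+-comm 1 n)) (+-monoʳ-≤ n (s≤s z≤n))))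

    zeros : zeroSquares m ≡ 1 + 2 * Z
    zeros = trans (Σ-reflect-even m (λ k → χ (sq% m k ≟ 0)) (λ a b a+b≡m → cong (λ r → χ (r ≟ 0)) (sq%-reflect m a b a+b≡m)) K (identity₂ L))
                  (cong (λ r → 1 + χ (r ≟ 0) + 2 * Z) sq%-middle)

    residues : 2 * (n + 2 * H) + m * (1 + 2 * Z) ≡ m * m
    residues = trans (cong₂ (λ R Z′ → 2 * R + m * Z′) (sym (trans (Σ-reflect-even m (sq% m) (sq%-reflect m) K (identity₂ L)) (cong (_+ 2 * H) sq%-middle))) (sym zeros))
                     (Σ-sq%-root-of-minus-one (pred m) {i} m∣i²+1)


module ValueOfF where

  open import Data.Nat as ℕ using (ℕ; suc)
  open import Data.Integer as ℤ using (ℤ; +_)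
  import Data.Integer.Properties as ℤ
  open import Data.Integer.Tactic.RingSolver using (solve-∀)
  open import Data.Rational as ℚ using (_/_)
  import Data.Rational.Properties as ℚ
  open import Data.Rational.Unnormalised as ℚᵘ using (mkℚᵘ; *≡*)
  import Data.Rational.Unnormalised.Properties as ℚᵘ
  open import Relation.Binary.PropositionalEquality
  open import Defs using (f; sqrtSum)

  toℚᵘ-/ : ∀ i d → ℚ.toℚᵘ (i / suc d) ℚᵘ.≃ mkℚᵘ i d
  toℚᵘ-/ i d = ℚ.toℚᵘ-fromℚᵘ (mkℚᵘ i d)

  f≡/4 : ∀ m N → let X = + (m ℕ.* m) ℤ.- + 1 in
         (+ sqrtSum m ℤ.* + 12 ℤ.+ (ℤ.- X) ℤ.* + 1) ℤ.* + 4 ≡ N ℤ.* + 12 → f m ≡ N / 4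
  f≡/4 m N cross = ℚ.toℚᵘ-injective (begin
    ℚ.toℚᵘ (f m)                                  ≈⟨ ℚ.toℚᵘ-homo-+ (+ S / 1) (ℚ.- (X / 12)) ⟩
    ℚ.toℚᵘ (+ S / 1) ℚᵘ.+ ℚ.toℚᵘ (ℚ.- (X / 12))   ≈⟨ ℚᵘ.+-cong (toℚᵘ-/ (+ S) 0) (ℚᵘ.≃-trans (ℚ.toℚᵘ-homo‿- (X / 12)) (ℚᵘ.-‿cong (toℚᵘ-/ X 11))) ⟩
    mkℚᵘ (+ S) 0 ℚᵘ.+ ℚᵘ.- mkℚᵘ X 11              ≈⟨ *≡* cross ⟩
    mkℚᵘ N 3                                      ≈⟨ toℚᵘ-/ N 3 ⟨
    ℚ.toℚᵘ (N / 4)                                ∎)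
    where
    open ℚᵘ.≃-Reasoning
    S = sqrtSum m
    X = + (m ℕ.* m) ℤ.- + 1

  -- e = 0 for m = n and e = n for m = 2n.
  f-value : ∀ m e Q → 12 ℕ.* sqrtSum m ℕ.+ (3 ℕ.* e ℕ.+ 4) ≡ m ℕ.* m ℕ.+ 3 ℕ.* Q →
            f m ≡ (+ Q ℤ.- + 1 ℤ.- + e) / 4
  f-value m e Q eq = f≡/4 m (+ Q ℤ.- + 1 ℤ.- + e) (begin
    (s ℤ.* + 12 ℤ.+ ℤ.- (mm ℤ.- + 1) ℤ.* + 1) ℤ.* + 4          ≡⟨ identity₁ s mm q (+ e) ⟩
    N ℤ.* + 12 ℤ.+ + 4 ℤ.* (lhs ℤ.- (mm ℤ.+ + 3 ℤ.* q))        ≡⟨ cong (λ x → N ℤ.* + 12 ℤ.+ + 4 ℤ.* (x ℤ.- (mm ℤ.+ + 3 ℤ.* q))) lifted ⟩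
    N ℤ.* + 12 ℤ.+ + 4 ℤ.* (mm ℤ.+ + 3 ℤ.* q ℤ.- (mm ℤ.+ + 3 ℤ.* q))
                                                              ≡⟨ identity₂ (N ℤ.* + 12) (mm ℤ.+ + 3 ℤ.* q) ⟩
    N ℤ.* + 12                                                ∎)
    where
    open ≡-Reasoning
    s mm q N lhs : ℤ
    s   = + sqrtSum m
    mm  = + (m ℕ.* m)
    q   = + Q
    N   = q ℤ.- + 1 ℤ.- + e
    lhs = + 12 ℤ.* s ℤ.+ (+ 3 ℤ.* + e ℤ.+ + 4)
    identity₁ : ∀ s mm q e → (s ℤ.* + 12 ℤ.+ ℤ.- (mm ℤ.- + 1) ℤ.* + 1) ℤ.* + 4
                             ≡ (q ℤ.- + 1 ℤ.- e) ℤ.* + 12 ℤ.+ + 4 ℤ.* ((+ 12 ℤ.* s ℤ.+ (+ 3 ℤ.* e ℤ.+ + 4)) ℤ.- (mm ℤ.+ + 3 ℤ.* q))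
    identity₁ = solve-∀
    identity₂ : ∀ a x → a ℤ.+ + 4 ℤ.* (x ℤ.- x) ≡ a
    identity₂ = solve-∀
    lifted : lhs ≡ mm ℤ.+ + 3 ℤ.* q
    lifted = begin
      + 12 ℤ.* s ℤ.+ (+ 3 ℤ.* + e ℤ.+ + 4)          ≡⟨ cong₂ (λ a b → a ℤ.+ (b ℤ.+ + 4)) (ℤ.pos-* 12 (sqrtSum m)) (ℤ.pos-* 3 e) ⟨
      + (12 ℕ.* sqrtSum m ℕ.+ (3 ℕ.* e ℕ.+ 4))      ≡⟨ cong +_ eq ⟩
      + (m ℕ.* m ℕ.+ 3 ℕ.* Q)                       ≡⟨ cong (λ x → mm ℤ.+ x) (ℤ.pos-* 3 Q) ⟩
      mm ℤ.+ + 3 ℤ.* q                              ∎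

  neg-/4 : ∀ i → (ℤ.- i) / 4 ≡ ℚ.- (i / 4)
  neg-/4 i = ℚ.toℚᵘ-injective (begin
    ℚ.toℚᵘ ((ℤ.- i) / 4)      ≈⟨ toℚᵘ-/ (ℤ.- i) 3 ⟩
    ℚᵘ.- mkℚᵘ i 3             ≈⟨ ℚᵘ.-‿cong (toℚᵘ-/ i 3) ⟨
    ℚᵘ.- ℚ.toℚᵘ (i / 4)       ≈⟨ ℚ.toℚᵘ-homo‿- (i / 4) ⟨
    ℚ.toℚᵘ (ℚ.- (i / 4))      ∎)
    where open ℚᵘ.≃-Reasoning


open import Defs
open import Data.Nat using (ℕ; _*_; _%_; _≥_)
open import Data.Nat.Primality using (Prime)
open import Data.List using (List; _∷_)
open import Data.Nat.ListAction using (product)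
open import Data.List.Relation.Unary.All using (All)
open import Data.Product using (_×_)
open import Data.Integer as ℤ using (+_)
open import Data.Rational as ℚ using (ℚ; _/_; 0ℚ)
open import Relation.Binary.PropositionalEquality using (_≡_)

import Data.Nat as ℕ
open import Data.Nat using (_+_; suc)
open import Data.Nat.Properties using (*-comm; *-identityʳ)
open import Data.Nat.DivMod using (m≡m%n+[m/n]*n; %-distribˡ-*)
open import Data.Nat.Divisibility using (_∣_)
open import Data.Nat.Tactic.RingSolver using (solve-∀)
import Data.Integer.Properties as ℤ
open import Data.List using ([])
open import Data.List.Relation.Unary.All using ([]; _∷_)
open import Data.Product using (_,_; map₂)
open import Relation.Nullary using (¬_)
open import Relation.Binary.PropositionalEquality using (refl; sym; trans; cong; cong₂; subst)
open SquareDivisors using (zeroSquares-squarefree*square; zeroSquares-2*squarefree*square)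
open RootOfMinusOne using (product-root; double-root; 2∤1+2*)
open SquareRootSum using (12*sqrtSum-odd; 12*sqrtSum-even)
open ValueOfF using (f-value; neg-/4)

product≡1mod4 : ∀ ps → All (λ q → Prime q × q % 4 ≡ 1) ps → product ps % 4 ≡ 1
product≡1mod4 []       []                = refl
product≡1mod4 (q ∷ ps) ((_ , q≡1) ∷ all) =
  trans (%-distribˡ-* q (product ps) 4) (cong₂ (λ a b → (a * b) % 4) q≡1 (product≡1mod4 ps all))

f-values : ∀ {n} L {i} P Q → n ≡ 1 + 4 * L → n ∣ i * i + 1 → SquareFree P → n ≡ P * (Q * Q) →
           (f n ≡ (+ Q ℤ.- + 1) / 4) × (f (2 * n) ≡ (+ Q ℤ.- + 1 ℤ.- + n) / 4)
f-values {n} L {i} P Q refl n∣i²+1 sf n≡PQ² = f-n , f-2n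
  where
  f-n : f n ≡ (+ Q ℤ.- + 1) / 4
  f-n = trans (f-value n 0 Q (trans (12*sqrtSum-odd L {i} n∣i²+1)
                                    (cong (λ Z → n * n + 3 * Z) (zeroSquares-squarefree*square P Q sf n≡PQ²))))
              (cong (_/ 4) (ℤ.+-identityʳ (+ Q ℤ.- + 1)))

  n≡1+2[2L] : n ≡ suc (2 * (2 * L))
  n≡1+2[2L] = identity L
    where
    identity : ∀ L → 1 + 4 * L ≡ suc (2 * (2 * L))
    identity = solve-∀

  2∤PQ² : ¬ 2 ∣ P * (Q * Q)
  2∤PQ² 2∣PQ² = 2∤1+2* (2 * L) (subst (2 ∣_) (trans (sym n≡PQ²) n≡1+2[2L]) 2∣PQ²)

  f-2n : f (2 * n) ≡ (+ Q ℤ.- + 1 ℤ.- + n) / 4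
  f-2n with double-root (2 * L) {i} n≡1+2[2L] n∣i²+1
  ... | j , 2n∣j²+1 = f-value (2 * n) n Q (trans (12*sqrtSum-even L {j} 2n∣j²+1)
    (cong (λ Z → 2 * n * (2 * n) + 3 * Z) (zeroSquares-2*squarefree*square P Q sf 2∤PQ² (cong (2 *_) n≡PQ²))))

proposition3p4 : (p : ℕ) (ps : List ℕ) → All (λ q → Prime q × q % 4 ≡ 1) (p ∷ ps) →
    ((P Q : ℕ) → SquareFree P → Q ≥ 1 → product (p ∷ ps) ≡ P * (Q * Q) →
      (f (product (p ∷ ps)) ≡ (+ Q ℤ.- + 1) / 4) ×
      (f (2 * product (p ∷ ps)) ≡ (+ Q ℤ.- + 1 ℤ.- + (product (p ∷ ps))) / 4)) ×
    (SquareFree (product (p ∷ ps)) →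
      (f (product (p ∷ ps)) ≡ 0ℚ) ×
      (f (2 * product (p ∷ ps)) ≡ ℚ.- ((+ (product (p ∷ ps))) / 4)))
proposition3p4 p ps primes = values , squarefree-values
  where
  n = product (p ∷ ps)

  n≡1+4L : n ≡ 1 + 4 * (n ℕ./ 4)
  n≡1+4L = trans (m≡m%n+[m/n]*n n 4) (cong₂ _+_ (product≡1mod4 (p ∷ ps) primes) (*-comm (n ℕ./ 4) 4))

  values : (P Q : ℕ) → SquareFree P → Q ≥ 1 → n ≡ P * (Q * Q) →
           (f n ≡ (+ Q ℤ.- + 1) / 4) × (f (2 * n) ≡ (+ Q ℤ.- + 1 ℤ.- + n) / 4)
  values P Q sf _ with product-root (p ∷ ps) primes
  ... | i , n∣i²+1 = f-values (n ℕ./ 4) {i} P Q n≡1+4L n∣i²+1 sf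

  squarefree-values : SquareFree n → (f n ≡ 0ℚ) × (f (2 * n) ≡ ℚ.- ((+ n) / 4))
  squarefree-values sf = map₂ (λ f-2n → trans f-2n (trans (cong (_/ 4) (ℤ.+-identityˡ (ℤ.- + n))) (neg-/4 (+ n))))
                              (values n 1 sf (ℕ.s≤s ℕ.z≤n) (sym (*-identityʳ n)))
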